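{- If $T$ is a tree, then $\operatorname{ses}(T)=0$ if $T$ is the trivial (one-vertex) graph, $\operatorname{ses}(T)=1$ if $T$ is a non-trivial path, and $\operatorname{ses}(T)=\mathfrak{H}(T)$ otherwise.
   Context: A weak homomorphism $f:G\to H$ is a map $f:V(G)\to V(H)$ such that for every edge $uv\in E(G)$, either $f(u)f(v)\in E(H)$ or $f(u)=f(v)$. It is edge surjective if $f(V(G))=V(H)$ and for every edge $uv\in E(H)$ there is an edge $xy\in E(G)$ with $f(x)=u$ and $f(y)=v$. For weak homomorphisms $f,g:G\to H$, $m_G(f,g)=\min\{d_H(f(u),g(u))\mid u\in V(G)\}$. For a connected graph $H$, the strong edge span is $\operatorname{ses}(H)=\max\{m_P(f,g)\mid P \text{ is a path and } f,g:P\to H \text{ are edge surjective weak homomorphisms}\}$. For a vertex $v$ of a tree $T$, the components of $T-\{v\}$ are its maximal connected subgraphs; for such a component $C(v)$, $\operatorname{reach}(C(v))=\max\{d(v,u)\mid u\in V(C(v))\cup\{v\}\}$. Denote the components of $T-\{v\}$ by $C_1(v),\dots,C_{\deg(v)}(v)$ with $\operatorname{reach}(C_i(v))\ge\operatorname{reach}(C_{i+1}(v))$. The triod size of $v$ is $\eta(v)=\operatorname{reach}(C_3(v))$ if $\deg(v)\ge 3$ and $\eta(v)=0$ if $\deg(v)\le 2$; the triod size of $T$ is $\mathfrak{H}(T)=\max\{\eta(v)\mid v\in V(T)\}$. -}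

module Defs where

open import Data.Nat using (ℕ; zero; suc; _≤_; _⊔_; _⊓_; _≡ᵇ_; _<ᵇ_; _≤ᵇ_)
open import Data.Bool using (Bool; true; false; _∨_; _∧_; not; if_then_else_)
open import Data.Bool.Properties using (∨-comm)
open import Data.Fin using (Fin; zero; suc; toℕ; inject₁; fromℕ) renaming (_≟_ to _≟ᶠ_)
open import Data.List using (List; []; _∷_; map)
open import Data.Product using (Σ; ∃; _×_; _,_)
open import Data.Sum using (_⊎_)
open import Data.Empty using (⊥)
open import Relation.Nullary using (¬_)
open import Relation.Nullary.Decidable using (⌊_⌋)
open import Relation.Binary.PropositionalEquality using (_≡_; refl)
open import Function using (_∘_)

anyFin : ∀ {n} → (Fin n → Bool) → Bool
anyFin {zero} p = false
anyFin {suc n} p = p zero ∨ anyFin (p ∘ suc)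

countFin : ∀ {n} → (Fin n → Bool) → ℕ
countFin {zero} p = 0
countFin {suc n} p = (if p zero then 1 else 0) Data.Nat.+ countFin (p ∘ suc)

maxFin : ∀ {n} → (Fin n → ℕ) → ℕ
maxFin {zero} f = 0
maxFin {suc n} f = f zero ⊔ maxFin (f ∘ suc)

minFin : ∀ {n} → (Fin (suc n) → ℕ) → ℕ
minFin {zero} f = f zero
minFin {suc n} f = f zero ⊓ minFin (f ∘ suc)

filterFin : ∀ {n} → (Fin n → Bool) → List (Fin n)
filterFin {zero} p = []
filterFin {suc n} p = let rest = map suc (filterFin (p ∘ suc)) in
  if p zero then zero ∷ rest else rest

insertDesc : ℕ → List ℕ → List ℕ
insertDesc x [] = x ∷ []
insertDesc x (y ∷ ys) = if y ≤ᵇ x then x ∷ y ∷ ys else y ∷ insertDesc x ys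

sortDesc : List ℕ → List ℕ
sortDesc [] = []
sortDesc (x ∷ xs) = insertDesc x (sortDesc xs)

-- i-th element (0-based) of a list, 0 if out of range
nth : ℕ → List ℕ → ℕ
nth _ [] = 0
nth zero (x ∷ xs) = x
nth (suc i) (x ∷ xs) = nth i xs

-- least i in {start, start+1, ..., start+fuel-1} with p i; start+fuel if none
search : (ℕ → Bool) → ℕ → ℕ → ℕ
search p i zero = i
search p i (suc f) = if p i then i else search p (suc i) f

reach≤ : ∀ {n} → (Fin n → Fin n → Bool) → ℕ → Fin n → Fin n → Bool
reach≤ a zero u v = ⌊ u ≟ᶠ v ⌋
reach≤ a (suc k) u v = reach≤ a k u v ∨ anyFin (λ w → reach≤ a k u w ∧ a w v)

record Graph : Set where
  field
    n      : ℕ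
    adj    : Fin n → Fin n → Bool
    sym    : ∀ u v → adj u v ≡ adj v u
    irrefl : ∀ u → adj u u ≡ false

open Graph public

V : Graph → Set
V G = Fin (n G)

Edge : (G : Graph) → V G → V G → Set
Edge G u v = adj G u v ≡ true

data Walk (G : Graph) : V G → V G → ℕ → Set where
  here : ∀ {u} → Walk G u u 0
  step : ∀ {u w v k} → Edge G u w → Walk G w v k → Walk G u v (suc k)

Connected : Graph → Set
Connected G = (1 ≤ n G) × (∀ u v → ∃ λ k → Walk G u v k)

-- a cycle: at least 3 pairwise distinct vertices c 0, ..., c (k+2),
-- consecutive ones adjacent and the last adjacent to the first
record Cycle (G : Graph) : Set where
  field
    k      : ℕ
    c      : Fin (suc (suc (suc k))) → V G
    inj    : ∀ i j → c i ≡ c j → i ≡ j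
    consec : ∀ (i : Fin (suc (suc k))) → Edge G (c (inject₁ i)) (c (suc i))
    close  : Edge G (c (fromℕ (suc (suc k)))) (c zero)

Acyclic : Graph → Set
Acyclic G = ¬ Cycle G

IsTree : Graph → Set
IsTree G = Connected G × Acyclic G

-- graph distance: least k with a walk of length ≤ k from u to v
-- (for connected graphs such k ≤ n - 1 always exists)
dist : (G : Graph) → V G → V G → ℕ
dist G u v = search (λ k → reach≤ (adj G) k u v) 0 (n G)

private
  ≡ᵇ-suc : ∀ m → (m ≡ᵇ suc m) ≡ false
  ≡ᵇ-suc zero = refl
  ≡ᵇ-suc (suc m) = ≡ᵇ-suc m

pathAdj : ∀ {m} → Fin m → Fin m → Bool
pathAdj i j = (toℕ i ≡ᵇ suc (toℕ j)) ∨ (toℕ j ≡ᵇ suc (toℕ i))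

PathGraph : ℕ → Graph
PathGraph m = record
  { n = m
  ; adj = pathAdj
  ; sym = λ i j → ∨-comm (toℕ i ≡ᵇ suc (toℕ j)) (toℕ j ≡ᵇ suc (toℕ i))
  ; irrefl = λ i → irr (toℕ i)
  }
  where
  irr : ∀ x → ((x ≡ᵇ suc x) ∨ (x ≡ᵇ suc x)) ≡ false
  irr x with x ≡ᵇ suc x | ≡ᵇ-suc x
  ... | false | refl = refl

record Iso (G H : Graph) : Set where
  field
    to      : V G → V H
    from    : V H → V G
    from∘to : ∀ x → from (to x) ≡ x
    to∘from : ∀ y → to (from y) ≡ y
    pres    : ∀ u v → adj H (to u) (to v) ≡ adj G u v

IsNontrivialPath : Graph → Set
IsNontrivialPath G = ∃ λ m → Iso G (PathGraph (suc (suc m)))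

IsTrivial : Graph → Set
IsTrivial G = n G ≡ 1

WeakHom : (G H : Graph) → (V G → V H) → Set
WeakHom G H f = ∀ u v → Edge G u v → Edge H (f u) (f v) ⊎ f u ≡ f v

EdgeSurjective : (G H : Graph) → (V G → V H) → Set
EdgeSurjective G H f =
  (∀ y → ∃ λ x → f x ≡ y) ×
  (∀ u v → Edge H u v → ∃ λ x → ∃ λ y → Edge G x y × f x ≡ u × f y ≡ v)

ESWH : (G H : Graph) → (V G → V H) → Set
ESWH G H f = WeakHom G H f × EdgeSurjective G H f

-- m_P(f,g) for P = PathGraph (suc k) (paths have at least one vertex)
mP : (H : Graph) (k : ℕ) → (f g : Fin (suc k) → V H) → ℕ
mP H k f g = minFin (λ u → dist H (f u) (g u))

-- "ses H = s": s is the maximum of m_P(f,g) over all paths P and all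
-- edge-surjective weak homomorphisms f, g : P → H
IsSes : Graph → ℕ → Set
IsSes H s =
  (∃ λ k → ∃ λ (f : Fin (suc k) → V H) → ∃ λ (g : Fin (suc k) → V H) →
     ESWH (PathGraph (suc k)) H f × ESWH (PathGraph (suc k)) H g × mP H k f g ≡ s) ×
  (∀ k (f g : Fin (suc k) → V H) →
     ESWH (PathGraph (suc k)) H f → ESWH (PathGraph (suc k)) H g → mP H k f g ≤ s)

module _ (T : Graph) where

  private
    neq : V T → V T → Bool
    neq x v = not ⌊ x ≟ᶠ v ⌋

  -- adjacency of T - {v} (v becomes isolated and is never used below)
  adjMinus : V T → V T → V T → Bool
  adjMinus v x y = adj T x y ∧ neq x v ∧ neq y v

  sameComp : V T → V T → V T → Bool
  sameComp v x y = reach≤ (adjMinus v) (n T) x y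

  -- u (≠ v) is the least-indexed vertex of its component of T - {v};
  -- these representatives enumerate the components of T - {v}
  isRep : V T → V T → Bool
  isRep v u = neq u v ∧
    not (anyFin (λ w → (toℕ w <ᵇ toℕ u) ∧ neq w v ∧ sameComp v w u))

  -- reach of the component C(v) containing u:
  -- max { d(v,x) | x ∈ V(C(v)) ∪ {v} }  (d(v,v) = 0 is the default 0)
  reachComp : V T → V T → ℕ
  reachComp v u = maxFin (λ x → if neq x v ∧ sameComp v u x then dist T v x else 0)

  degree : V T → ℕ
  degree v = countFin (adj T v)

  -- reaches of C_1(v), C_2(v), ... in non-increasing order
  sortedReaches : V T → List ℕ
  sortedReaches v = sortDesc (map (reachComp v) (filterFin (isRep v)))

  -- η(v) = reach(C_3(v)) if deg v ≥ 3, and 0 otherwise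
  eta : V T → ℕ
  eta v = if 3 ≤ᵇ degree v then nth 2 (sortedReaches v) else 0

  triodSize : ℕ
  triodSize = maxFin eta

-- Upper bound. Fix a diameter u₀ = p 0, ..., p L = u₁ of T (the spine) and let π x be the index of the
-- spine vertex from which x hangs. A vertex hanging at p i at distance d from it is the tip of a triod
-- at p i of size d, because by maximality of the diameter u₀ and u₁ are at least d away from p i. So if
-- two edge-surjective weak homomorphisms f, g from a path stay more than max(1, 𝔥(T)) apart, then
-- f t and g t never share a spine vertex, and the order of π (f t) and π (g t) can only change when both
-- sit on adjacent spine vertices. The order is therefore constant, which is impossible: the map that is
-- behind must still visit u₁ = p L, and if they are level, f visiting u₀ = p 0 puts both at index 0.
--
-- Lower bound. At a vertex v with η(v) = 𝔥(T) take tips a₁, a₂, a₃ at distance ≥ 𝔥(T) from v in three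
-- components of T - v. Every vertex outside the component of aᵢ is ≥ 𝔥(T) away from aᵢ, so one map
-- can tour all edges outside that component while the other waits at aᵢ; as no edge meets two
-- components, touring outside a₁ and outside a₂ covers every edge. On a path, f and g chase each other
-- along the spine at distance ≥ 1; and a tree with 𝔥(T) = 0 is its own spine, hence a path.

module Submission where

open import Defs renaming (sym to adj-sym)
open import Data.Bool using (Bool; true; false; _∨_; _∧_; not; if_then_else_; T)
open import Data.Bool.Properties using (∧-comm)
open import Data.Empty using (⊥)
open import Data.Fin using (Fin; zero; suc; toℕ; inject₁; fromℕ; fromℕ<) renaming (_≟_ to _≟ᶠ_)
open import Data.Fin.Properties using (toℕ<n; pigeonhole; toℕ-injective; toℕ-inject₁; toℕ-fromℕ; toℕ-fromℕ<)
open import Data.List using (List; []; _∷_; map; length; allFin; cartesianProduct)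
open import Data.List.Membership.Propositional using (_∈_)
open import Data.List.Membership.Propositional.Properties using (∈-allFin; ∈-cartesianProduct⁺)
open import Data.List.Properties using (map-∘)
open import Data.List.Relation.Unary.All as All using (All; []; _∷_)
open import Data.List.Relation.Unary.Any using (here; there)
open import Data.Nat using (ℕ; zero; suc; _+_; _≤_; _<_; z≤n; s≤s; _≤ᵇ_; _<ᵇ_; _≡ᵇ_; _∸_; z<s; _≟_)
open import Data.Nat.Properties
open import Algebra.Properties.CommutativeSemigroup +-commutativeSemigroup using (x∙yz≈y∙xz)
open import Data.Product using (∃; _×_; _,_; Σ; proj₁; proj₂)
open import Data.Sum using (_⊎_; inj₁; inj₂; [_,_]′)
import Data.Sum as Sum
open import Data.Unit using (⊤; tt)
open import Function using (_∘_; _⇔_; mk⇔; Equivalence)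
open import Relation.Binary.Definitions using (tri<; tri≈; tri>)
open import Relation.Binary.PropositionalEquality using (_≡_; refl; cong; subst; trans; _≢_; sym; subst₂; cong₂)
open import Relation.Nullary using (¬_; yes; no; contradiction; Dec)
open import Relation.Nullary.Decidable using (⌊_⌋)
open import Relation.Unary using (U)

true≢false : true ≢ false
true≢false ()

T⇒≡true : ∀ {b} → T b → b ≡ true
T⇒≡true {true} _ = refl

≡true⇒T : ∀ {b} → b ≡ true → T b
≡true⇒T refl = tt

≤⇒≤ᵇ≡true : ∀ {m n} → m ≤ n → (m ≤ᵇ n) ≡ true
≤⇒≤ᵇ≡true = T⇒≡true ∘ ≤⇒≤ᵇ

≤ᵇ≡true⇒≤ : ∀ m n → (m ≤ᵇ n) ≡ true → m ≤ n
≤ᵇ≡true⇒≤ m n = ≤ᵇ⇒≤ m n ∘ ≡true⇒T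

>⇒≤ᵇ≡false : ∀ {m n} → n < m → (m ≤ᵇ n) ≡ false
>⇒≤ᵇ≡false {m} {n} n<m with m ≤ᵇ n in eq
... | true = contradiction (≤ᵇ≡true⇒≤ m n eq) (<⇒≱ n<m)
... | false = refl

≤ᵇ≡false⇒> : ∀ m n → (m ≤ᵇ n) ≡ false → n < m
≤ᵇ≡false⇒> m n eq = ≰⇒> λ m≤n → true≢false (trans (sym (≤⇒≤ᵇ≡true m≤n)) eq)

<⇒<ᵇ≡true : ∀ {m n} → m < n → (m <ᵇ n) ≡ true
<⇒<ᵇ≡true = T⇒≡true ∘ <⇒<ᵇ

<ᵇ≡true⇒< : ∀ m n → (m <ᵇ n) ≡ true → m < n
<ᵇ≡true⇒< m n = <ᵇ⇒< m n ∘ ≡true⇒T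

≡⇒≡ᵇ≡true : ∀ m n → m ≡ n → (m ≡ᵇ n) ≡ true
≡⇒≡ᵇ≡true m n = T⇒≡true ∘ ≡⇒≡ᵇ m n

≡ᵇ≡true⇒≡ : ∀ m n → (m ≡ᵇ n) ≡ true → m ≡ n
≡ᵇ≡true⇒≡ m n = ≡ᵇ⇒≡ m n ∘ ≡true⇒T

∨≡trueˡ : ∀ {x} y → x ≡ true → x ∨ y ≡ true
∨≡trueˡ y refl = refl

∨≡trueʳ : ∀ x {y} → y ≡ true → x ∨ y ≡ true
∨≡trueʳ true _ = refl
∨≡trueʳ false y≡true = y≡true

∨≡true⇒ : ∀ x {y} → x ∨ y ≡ true → x ≡ true ⊎ y ≡ true
∨≡true⇒ true _ = inj₁ refl
∨≡true⇒ false y≡true = inj₂ y≡true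

∧≡true : ∀ {x y} → x ≡ true → y ≡ true → x ∧ y ≡ true
∧≡true refl refl = refl

∧≡true⇒ : ∀ x {y} → x ∧ y ≡ true → x ≡ true × y ≡ true
∧≡true⇒ true y≡true = refl , y≡true

≡true⇔⇒≡ : ∀ {x y} → (x ≡ true → y ≡ true) → (y ≡ true → x ≡ true) → x ≡ y
≡true⇔⇒≡ {true} x⇒y _ = sym (x⇒y refl)
≡true⇔⇒≡ {false} {true} _ y⇒x = y⇒x refl
≡true⇔⇒≡ {false} {false} _ _ = refl

not≡true : ∀ {x} → x ≡ false → not x ≡ true
not≡true refl = refl

not≡true⇒ : ∀ x → not x ≡ true → x ≡ false
not≡true⇒ false _ = refl

not≡false⇒ : ∀ x → not x ≡ false → x ≡ true
not≡false⇒ true _ = refl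

⌊≟⌋≡true⇒≡ : ∀ {m} (u v : Fin m) → ⌊ u ≟ᶠ v ⌋ ≡ true → u ≡ v
⌊≟⌋≡true⇒≡ u v eq with u ≟ᶠ v
... | yes u≡v = u≡v

⌊≟⌋-refl : ∀ {m} (u : Fin m) → ⌊ u ≟ᶠ u ⌋ ≡ true
⌊≟⌋-refl u with u ≟ᶠ u
... | yes _ = refl
... | no u≢u = contradiction refl u≢u

-- the test `neq` used (privately) in the definition of `adjMinus`
_≢ᵇ_ : ∀ {m} → Fin m → Fin m → Bool
x ≢ᵇ v = not ⌊ x ≟ᶠ v ⌋

≢ᵇ≡true⇒≢ : ∀ {m} (x v : Fin m) → x ≢ᵇ v ≡ true → x ≢ v
≢ᵇ≡true⇒≢ x v eq refl rewrite ⌊≟⌋-refl x = true≢false (sym eq)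

≢⇒≢ᵇ≡true : ∀ {m} (x v : Fin m) → x ≢ v → x ≢ᵇ v ≡ true
≢⇒≢ᵇ≡true x v x≢v with x ≟ᶠ v
... | yes x≡v = contradiction x≡v x≢v
... | no _ = refl

search-≤ : ∀ p i f → search p i f ≤ i + f
search-≤ p i zero = ≤-reflexive (sym (+-identityʳ i))
search-≤ p i (suc f) with p i
... | true = m≤m+n i (suc f)
... | false = ≤-trans (search-≤ p (suc i) f) (≤-reflexive (sym (+-suc i f)))

search-≤-hit : ∀ p i f k → p k ≡ true → i ≤ k → search p i f ≤ k
search-≤-hit p i zero k _ i≤k = i≤k
search-≤-hit p i (suc f) k pk i≤k with p i in pi
... | true = i≤k
... | false with m≤n⇒m<n∨m≡n i≤k
...   | inj₁ i<k = search-≤-hit p (suc i) f k pk i<k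
...   | inj₂ refl = contradiction (trans (sym pk) pi) true≢false

search-miss : ∀ p i f j → i ≤ j → j < search p i f → p j ≡ false
search-miss p i zero j i≤j j<s = contradiction i≤j (<⇒≱ j<s)
search-miss p i (suc f) j i≤j j<s with p i in pi
... | true = contradiction i≤j (<⇒≱ j<s)
... | false with m≤n⇒m<n∨m≡n i≤j
...   | inj₁ i<j = search-miss p (suc i) f j i<j j<s
...   | inj₂ refl = pi

search-hit : ∀ p i f → search p i f < i + f → p (search p i f) ≡ true
search-hit p i zero s<i = contradiction s<i (≤⇒≯ (≤-reflexive (+-identityʳ i)))
search-hit p i (suc f) s< with p i in pi
... | true = pi
... | false = search-hit p (suc i) f (subst (search p (suc i) f <_) (+-suc i f) s<)

anyFin-true : ∀ {m} (p : Fin m → Bool) i → p i ≡ true → anyFin p ≡ true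
anyFin-true p zero pi = ∨≡trueˡ _ pi
anyFin-true p (suc i) pi = ∨≡trueʳ (p zero) (anyFin-true (p ∘ suc) i pi)

anyFin-true⇒ : ∀ {m} (p : Fin m → Bool) → anyFin p ≡ true → ∃ λ i → p i ≡ true
anyFin-true⇒ {suc m} p any with ∨≡true⇒ (p zero) any
... | inj₁ p0 = zero , p0
... | inj₂ rest with anyFin-true⇒ (p ∘ suc) rest
...   | i , pi = suc i , pi

≤-maxFin : ∀ {m} (f : Fin m → ℕ) i → f i ≤ maxFin f
≤-maxFin f zero = m≤m⊔n _ _
≤-maxFin f (suc i) = ≤-trans (≤-maxFin (f ∘ suc) i) (m≤n⊔m (f zero) _)

maxFin-≤ : ∀ {m} (f : Fin m → ℕ) {c} → (∀ i → f i ≤ c) → maxFin f ≤ c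
maxFin-≤ {zero} f _ = z≤n
maxFin-≤ {suc m} f bound = ⊔-lub (bound zero) (maxFin-≤ (f ∘ suc) (bound ∘ suc))

maxFin-attained : ∀ {m} (f : Fin m → ℕ) → Fin m → ∃ λ i → maxFin f ≡ f i
maxFin-attained {suc zero} f _ = zero , ⊔-identityʳ (f zero)
maxFin-attained {suc (suc m)} f _ with maxFin-attained (f ∘ suc) zero | ≤-total (f zero) (maxFin (f ∘ suc))
... | i , eq | inj₁ le = suc i , trans (m≤n⇒m⊔n≡n le) eq
... | _ | inj₂ ge = zero , m≥n⇒m⊔n≡m ge

≤-maxFin⇒ : ∀ {m} (f : Fin m → ℕ) {h} → 1 ≤ h → h ≤ maxFin f → ∃ λ i → h ≤ f i
≤-maxFin⇒ {zero} f 1≤h h≤0 = contradiction h≤0 (<⇒≱ 1≤h)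
≤-maxFin⇒ {suc m} f 1≤h h≤max with ≤-total (f zero) (maxFin (f ∘ suc))
... | inj₁ le with ≤-maxFin⇒ (f ∘ suc) 1≤h (≤-trans h≤max (≤-reflexive (m≤n⇒m⊔n≡n le)))
...   | i , h≤fi = suc i , h≤fi
≤-maxFin⇒ {suc m} f 1≤h h≤max | inj₂ ge = zero , ≤-trans h≤max (≤-reflexive (m≥n⇒m⊔n≡m ge))

minFin-≤ : ∀ {m} (f : Fin (suc m) → ℕ) i → minFin f ≤ f i
minFin-≤ {zero} f zero = ≤-refl
minFin-≤ {suc m} f zero = m⊓n≤m _ _
minFin-≤ {suc m} f (suc i) = ≤-trans (m⊓n≤n (f zero) _) (minFin-≤ (f ∘ suc) i)

≤-minFin : ∀ {m} (f : Fin (suc m) → ℕ) {c} → (∀ i → c ≤ f i) → c ≤ minFin f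
≤-minFin {zero} f bound = bound zero
≤-minFin {suc m} f bound = ⊓-glb (bound zero) (≤-minFin (f ∘ suc) (bound ∘ suc))

indicator≤1 : ∀ b → (if b then 1 else 0) ≤ 1
indicator≤1 true = ≤-refl
indicator≤1 false = z≤n

countFin-tail : ∀ {m} (p : Fin (suc m) → Bool) → countFin (p ∘ suc) ≤ countFin p
countFin-tail p = m≤n+m _ (if p zero then 1 else 0)

suc-≢ : ∀ {m} {i j : Fin m} → i ≢ j → Fin.suc i ≢ suc j
suc-≢ i≢j refl = i≢j refl

1≤countFin⇒ : ∀ {m} (p : Fin m → Bool) → 1 ≤ countFin p → ∃ λ i → p i ≡ true
1≤countFin⇒ {suc m} p c with p zero in p0
... | true = zero , p0
... | false with 1≤countFin⇒ (p ∘ suc) c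
...   | i , pi = suc i , pi

2≤countFin⇒ : ∀ {m} (p : Fin m → Bool) → 2 ≤ countFin p →
  ∃ λ i → ∃ λ j → i ≢ j × p i ≡ true × p j ≡ true
2≤countFin⇒ {suc m} p c with p zero in p0
... | true with 1≤countFin⇒ (p ∘ suc) (≤-pred c)
...   | j , pj = zero , suc j , (λ ()) , p0 , pj
2≤countFin⇒ {suc m} p c | false with 2≤countFin⇒ (p ∘ suc) c
...   | i , j , i≢j , pi , pj = suc i , suc j , suc-≢ i≢j , pi , pj

3≤countFin⇒ : ∀ {m} (p : Fin m → Bool) → 3 ≤ countFin p →
  ∃ λ i → ∃ λ j → ∃ λ k → i ≢ j × i ≢ k × j ≢ k × p i ≡ true × p j ≡ true × p k ≡ true
3≤countFin⇒ {suc m} p c with p zero in p0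
... | true with 2≤countFin⇒ (p ∘ suc) (≤-pred c)
...   | j , k , j≢k , pj , pk = zero , suc j , suc k , (λ ()) , (λ ()) , suc-≢ j≢k , p0 , pj , pk
3≤countFin⇒ {suc m} p c | false with 3≤countFin⇒ (p ∘ suc) c
...   | i , j , k , i≢j , i≢k , j≢k , pi , pj , pk =
  suc i , suc j , suc k , suc-≢ i≢j , suc-≢ i≢k , suc-≢ j≢k , pi , pj , pk

⇒1≤countFin : ∀ {m} (p : Fin m → Bool) i → p i ≡ true → 1 ≤ countFin p
⇒1≤countFin p zero pi rewrite pi = s≤s z≤n
⇒1≤countFin p (suc i) pi = ≤-trans (⇒1≤countFin (p ∘ suc) i pi) (countFin-tail p)

⇒2≤countFin : ∀ {m} (p : Fin m → Bool) i j → i ≢ j → p i ≡ true → p j ≡ true → 2 ≤ countFin p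
⇒2≤countFin p zero zero i≢j _ _ = contradiction refl i≢j
⇒2≤countFin p zero (suc j) _ pi pj rewrite pi = s≤s (⇒1≤countFin (p ∘ suc) j pj)
⇒2≤countFin p (suc i) zero _ pi pj rewrite pj = s≤s (⇒1≤countFin (p ∘ suc) i pi)
⇒2≤countFin p (suc i) (suc j) i≢j pi pj =
  ≤-trans (⇒2≤countFin (p ∘ suc) i j (i≢j ∘ cong suc) pi pj) (countFin-tail p)

⇒3≤countFin : ∀ {m} (p : Fin m → Bool) i j k → i ≢ j → i ≢ k → j ≢ k →
  p i ≡ true → p j ≡ true → p k ≡ true → 3 ≤ countFin p
⇒3≤countFin p zero zero k i≢j _ _ _ _ _ = contradiction refl i≢j
⇒3≤countFin p zero (suc j) zero _ i≢k _ _ _ _ = contradiction refl i≢k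
⇒3≤countFin p (suc i) zero zero _ _ j≢k _ _ _ = contradiction refl j≢k
⇒3≤countFin p zero (suc j) (suc k) _ _ j≢k pi pj pk rewrite pi =
  s≤s (⇒2≤countFin (p ∘ suc) j k (j≢k ∘ cong suc) pj pk)
⇒3≤countFin p (suc i) zero (suc k) _ i≢k _ pi pj pk rewrite pj =
  s≤s (⇒2≤countFin (p ∘ suc) i k (i≢k ∘ cong suc) pi pk)
⇒3≤countFin p (suc i) (suc j) zero i≢j _ _ pi pj pk rewrite pk =
  s≤s (⇒2≤countFin (p ∘ suc) i j (i≢j ∘ cong suc) pi pj)
⇒3≤countFin p (suc i) (suc j) (suc k) i≢j i≢k j≢k pi pj pk =
  ≤-trans (⇒3≤countFin (p ∘ suc) i j k (i≢j ∘ cong suc) (i≢k ∘ cong suc) (j≢k ∘ cong suc) pi pj pk)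
          (countFin-tail p)

countGE : ℕ → List ℕ → ℕ
countGE h [] = 0
countGE h (x ∷ xs) = (if h ≤ᵇ x then 1 else 0) + countGE h xs

Descending : List ℕ → Set
Descending [] = ⊤
Descending (x ∷ xs) = All (_≤ x) xs × Descending xs

insertDesc-All : ∀ {P : ℕ → Set} x ys → All P ys → P x → All P (insertDesc x ys)
insertDesc-All x [] _ px = px ∷ []
insertDesc-All x (y ∷ ys) (py ∷ pys) px with y ≤ᵇ x
... | true = px ∷ py ∷ pys
... | false = py ∷ insertDesc-All x ys pys px

insertDesc-descending : ∀ x ys → Descending ys → Descending (insertDesc x ys)
insertDesc-descending x [] _ = [] , tt
insertDesc-descending x (y ∷ ys) (ys≤y , desc) with y ≤ᵇ x in y≤ᵇx
... | true = (y≤x ∷ All.map (λ z≤y → ≤-trans z≤y y≤x) ys≤y) , ys≤y , desc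
  where
  y≤x : y ≤ x
  y≤x = ≤ᵇ≡true⇒≤ y x y≤ᵇx
... | false = insertDesc-All x ys ys≤y (<⇒≤ (≤ᵇ≡false⇒> y x y≤ᵇx)) , insertDesc-descending x ys desc

sortDesc-descending : ∀ xs → Descending (sortDesc xs)
sortDesc-descending [] = tt
sortDesc-descending (x ∷ xs) = insertDesc-descending x (sortDesc xs) (sortDesc-descending xs)

countGE-insertDesc : ∀ h x ys → countGE h (insertDesc x ys) ≡ countGE h (x ∷ ys)
countGE-insertDesc h x [] = refl
countGE-insertDesc h x (y ∷ ys) with y ≤ᵇ x
... | true = refl
... | false = trans (cong ((if h ≤ᵇ y then 1 else 0) +_) (countGE-insertDesc h x ys))
                    (x∙yz≈y∙xz (if h ≤ᵇ y then 1 else 0) (if h ≤ᵇ x then 1 else 0) (countGE h ys))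

countGE-sortDesc : ∀ h xs → countGE h (sortDesc xs) ≡ countGE h xs
countGE-sortDesc h [] = refl
countGE-sortDesc h (x ∷ xs) =
  trans (countGE-insertDesc h x (sortDesc xs)) (cong ((if h ≤ᵇ x then 1 else 0) +_) (countGE-sortDesc h xs))

countGE≤length : ∀ h xs → countGE h xs ≤ length xs
countGE≤length h [] = z≤n
countGE≤length h (x ∷ xs) = +-mono-≤ (indicator≤1 (h ≤ᵇ x)) (countGE≤length h xs)

countGE-below : ∀ h xs → All (_< h) xs → countGE h xs ≡ 0
countGE-below h [] _ = refl
countGE-below h (x ∷ xs) (x<h ∷ xs<h) rewrite >⇒≤ᵇ≡false x<h = countGE-below h xs xs<h

3≤countGE⇒≤nth2 : ∀ h xs → Descending xs → 3 ≤ countGE h xs → h ≤ nth 2 xs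
3≤countGE⇒≤nth2 h [] _ ()
3≤countGE⇒≤nth2 h (x ∷ []) _ c = contradiction (≤-trans c (countGE≤length h (x ∷ []))) λ { (s≤s ()) }
3≤countGE⇒≤nth2 h (x ∷ y ∷ []) _ c =
  contradiction (≤-trans c (countGE≤length h (x ∷ y ∷ []))) λ { (s≤s (s≤s ())) }
3≤countGE⇒≤nth2 h (x ∷ y ∷ z ∷ rest) (_ , _ , rest≤z , _) c with h ≤? z
... | yes h≤z = h≤z
... | no h≰z = contradiction c (<⇒≱ (s≤s atMost2))
  where
  atMost2 : countGE h (x ∷ y ∷ z ∷ rest) ≤ 2
  atMost2 = +-mono-≤ (indicator≤1 (h ≤ᵇ x)) (+-mono-≤ (indicator≤1 (h ≤ᵇ y))
              (≤-reflexive (countGE-below h (z ∷ rest)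
                 (All.map (λ w≤z → ≤-<-trans w≤z (≰⇒> h≰z)) (≤-refl ∷ rest≤z)))))

≤nth2⇒3≤countGE : ∀ h xs → Descending xs → 1 ≤ h → h ≤ nth 2 xs → 3 ≤ countGE h xs
≤nth2⇒3≤countGE h (x ∷ y ∷ z ∷ rest) ((y≤x ∷ z≤x ∷ _) , (z≤y ∷ _) , _) _ h≤z
  rewrite ≤⇒≤ᵇ≡true (≤-trans h≤z z≤x) | ≤⇒≤ᵇ≡true (≤-trans h≤z z≤y) | ≤⇒≤ᵇ≡true h≤z =
  s≤s (s≤s (s≤s z≤n))
≤nth2⇒3≤countGE h [] _ 1≤h h≤0 = contradiction h≤0 (<⇒≱ 1≤h)
≤nth2⇒3≤countGE h (_ ∷ []) _ 1≤h h≤0 = contradiction h≤0 (<⇒≱ 1≤h)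
≤nth2⇒3≤countGE h (_ ∷ _ ∷ []) _ 1≤h h≤0 = contradiction h≤0 (<⇒≱ 1≤h)

≤thirdLargest⇔ : ∀ h xs → 1 ≤ h → h ≤ nth 2 (sortDesc xs) ⇔ 3 ≤ countGE h xs
≤thirdLargest⇔ h xs 1≤h = mk⇔
  (λ h≤ → subst (3 ≤_) (countGE-sortDesc h xs) (≤nth2⇒3≤countGE h (sortDesc xs) (sortDesc-descending xs) 1≤h h≤))
  (λ 3≤ → 3≤countGE⇒≤nth2 h (sortDesc xs) (sortDesc-descending xs) (subst (3 ≤_) (sym (countGE-sortDesc h xs)) 3≤))

countGE-map-filterFin : ∀ {m} (p : Fin m → Bool) (f : Fin m → ℕ) h →
  countGE h (map f (filterFin p)) ≡ countFin (λ i → p i ∧ (h ≤ᵇ f i))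
countGE-map-filterFin {zero} p f h = refl
countGE-map-filterFin {suc m} p f h with p zero | tail
  where
  tail : countGE h (map f (map suc (filterFin (p ∘ suc)))) ≡ countFin (λ i → p (suc i) ∧ (h ≤ᵇ f (suc i)))
  tail = trans (cong (countGE h) (sym (map-∘ (filterFin (p ∘ suc))))) (countGE-map-filterFin (p ∘ suc) (f ∘ suc) h)
... | true | tail = cong ((if h ≤ᵇ f zero then 1 else 0) +_) tail
... | false | tail = tail

-- Chains and lazy walks

module _ {A : Set} where

  Linked : (A → A → Set) → (ℕ → A) → ℕ → Set
  Linked R w k = ∀ i → i < k → R (w i) (w (suc i))

  AllUpTo : (A → Set) → (ℕ → A) → ℕ → Set
  AllUpTo P w k = ∀ i → i ≤ k → P (w i)

  SomeStep : (A → A → Set) → (ℕ → A) → ℕ → Set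
  SomeStep Q w k = ∃ λ i → i < k × Q (w i) (w (suc i))

  StepIs : A → A → A → A → Set
  StepIs x y a b = a ≡ x × b ≡ y

  joinAt : ℕ → (ℕ → A) → (ℕ → A) → ℕ → A
  joinAt k w₁ w₂ i = if i ≤ᵇ k then w₁ i else w₂ (i ∸ k)

  joinAt-≤ : ∀ k (w₁ w₂ : ℕ → A) i → i ≤ k → joinAt k w₁ w₂ i ≡ w₁ i
  joinAt-≤ k w₁ w₂ i i≤k rewrite ≤⇒≤ᵇ≡true i≤k = refl

  joinAt-> : ∀ k (w₁ w₂ : ℕ → A) i → k < i → joinAt k w₁ w₂ i ≡ w₂ (i ∸ k)
  joinAt-> k w₁ w₂ i k<i rewrite >⇒≤ᵇ≡false k<i = refl

  joinAt-+ : ∀ k (w₁ w₂ : ℕ → A) j → w₁ k ≡ w₂ 0 → joinAt k w₁ w₂ (k + j) ≡ w₂ j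
  joinAt-+ k w₁ w₂ zero meet rewrite +-identityʳ k = trans (joinAt-≤ k w₁ w₂ k ≤-refl) meet
  joinAt-+ k w₁ w₂ (suc j) _ =
    trans (joinAt-> k w₁ w₂ (k + suc j) (m<m+n k z<s)) (cong w₂ (m+n∸m≡n k (suc j)))

  joinAt-+suc : ∀ k (w₁ w₂ : ℕ → A) j → w₁ k ≡ w₂ 0 → joinAt k w₁ w₂ (suc (k + j)) ≡ w₂ (suc j)
  joinAt-+suc k w₁ w₂ j meet = trans (cong (joinAt k w₁ w₂) (sym (+-suc k j))) (joinAt-+ k w₁ w₂ (suc j) meet)

  joinAt-linked : ∀ {R} k₁ k₂ (w₁ w₂ : ℕ → A) → Linked R w₁ k₁ → Linked R w₂ k₂ → w₁ k₁ ≡ w₂ 0 →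
    Linked R (joinAt k₁ w₁ w₂) (k₁ + k₂)
  joinAt-linked {R} k₁ k₂ w₁ w₂ l₁ l₂ meet i i< with i <? k₁
  ... | yes i<k₁ =
    subst₂ R (sym (joinAt-≤ k₁ w₁ w₂ i (<⇒≤ i<k₁))) (sym (joinAt-≤ k₁ w₁ w₂ (suc i) i<k₁)) (l₁ i i<k₁)
  ... | no i≮k₁ with m≤n⇒∃[o]m+o≡n (≮⇒≥ i≮k₁)
  ...   | j , refl = subst₂ R (sym (joinAt-+ k₁ w₁ w₂ j meet)) (sym (joinAt-+suc k₁ w₁ w₂ j meet))
                       (l₂ j (+-cancelˡ-< k₁ j k₂ i<))

  joinAt-allUpTo : ∀ {P} k₁ k₂ (w₁ w₂ : ℕ → A) → AllUpTo P w₁ k₁ → AllUpTo P w₂ k₂ →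
    AllUpTo P (joinAt k₁ w₁ w₂) (k₁ + k₂)
  joinAt-allUpTo {P} k₁ k₂ w₁ w₂ a₁ a₂ i i≤ with i ≤? k₁
  ... | yes i≤k₁ = subst P (sym (joinAt-≤ k₁ w₁ w₂ i i≤k₁)) (a₁ i i≤k₁)
  ... | no i≰k₁ = subst P (sym (joinAt-> k₁ w₁ w₂ i (≰⇒> i≰k₁)))
                    (a₂ (i ∸ k₁) (subst (i ∸ k₁ ≤_) (m+n∸m≡n k₁ k₂) (∸-monoˡ-≤ k₁ i≤)))

  joinAt-someStepˡ : ∀ {Q} k₁ k₂ (w₁ w₂ : ℕ → A) → SomeStep Q w₁ k₁ →
    SomeStep Q (joinAt k₁ w₁ w₂) (k₁ + k₂)
  joinAt-someStepˡ {Q} k₁ k₂ w₁ w₂ (i , i< , q) =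
    i , <-≤-trans i< (m≤m+n k₁ k₂) ,
    subst₂ Q (sym (joinAt-≤ k₁ w₁ w₂ i (<⇒≤ i<))) (sym (joinAt-≤ k₁ w₁ w₂ (suc i) i<)) q

  joinAt-someStepʳ : ∀ {Q} k₁ k₂ (w₁ w₂ : ℕ → A) → w₁ k₁ ≡ w₂ 0 → SomeStep Q w₂ k₂ →
    SomeStep Q (joinAt k₁ w₁ w₂) (k₁ + k₂)
  joinAt-someStepʳ {Q} k₁ k₂ w₁ w₂ meet (j , j< , q) =
    k₁ + j , +-monoʳ-< k₁ j< ,
    subst₂ Q (sym (joinAt-+ k₁ w₁ w₂ j meet)) (sym (joinAt-+suc k₁ w₁ w₂ j meet)) q

  -- `at` is a whole sequence; its entries beyond `len` are junk
  record Chain (R : A → A → Set) (P : A → Set) (x y : A) : Set where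
    constructor chain
    field
      len    : ℕ
      at     : ℕ → A
      steps  : Linked R at len
      inside : AllUpTo P at len
      start  : at 0 ≡ x
      end    : at len ≡ y

  open Chain public

  HasStep : ∀ {R P x y} → (A → A → Set) → Chain R P x y → Set
  HasStep Q c = SomeStep Q (at c) (len c)

  _++ᶜ_ : ∀ {R P x y z} → Chain R P x y → Chain R P y z → Chain R P x z
  _++ᶜ_ {R} {P} c d = chain (len c + len d) (joinAt (len c) (at c) (at d))
    (joinAt-linked {R} (len c) (len d) (at c) (at d) (steps c) (steps d) meet)
    (joinAt-allUpTo {P} (len c) (len d) (at c) (at d) (inside c) (inside d))
    (trans (joinAt-≤ (len c) (at c) (at d) 0 z≤n) (start c))
    (trans (joinAt-+ (len c) (at c) (at d) (len d) meet) (end d))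
    where
    meet : at c (len c) ≡ at d 0
    meet = trans (end c) (sym (start d))

  infixr 5 _++ᶜ_

  nilᶜ : ∀ {R} {P : A → Set} {x} → P x → Chain R P x x
  nilᶜ {x = x} px = chain 0 (λ _ → x) (λ _ ()) (λ _ _ → px) refl refl

  stepᶜ : ∀ {R} {P : A → Set} {x y} → P x → P y → R x y → Chain R P x y
  stepᶜ {R} {P} {x} {y} px py r = chain 1 xy linked inP refl refl
    where
    xy : ℕ → A
    xy i = if i ≤ᵇ 0 then x else y
    linked : Linked R xy 1
    linked zero _ = r
    linked (suc _) (s≤s ())
    inP : AllUpTo P xy 1
    inP zero _ = px
    inP (suc zero) _ = py
    inP (suc (suc _)) (s≤s ())

  ∸≡suc∸suc : ∀ {k i} → i < k → k ∸ i ≡ suc (k ∸ suc i)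
  ∸≡suc∸suc {k} {i} i<k = +-∸-assoc 1 {k} {suc i} i<k

  reverseᶜ : ∀ {R P x y} → (∀ {a b} → R a b → R b a) → Chain R P x y → Chain R P y x
  reverseᶜ {R} {P} R-sym c = chain (len c) (λ i → at c (len c ∸ i)) linked
    (λ i _ → inside c (len c ∸ i) (m∸n≤m (len c) i)) (end c)
    (trans (cong (at c) (n∸n≡0 (len c))) (start c))
    where
    linked : Linked R (λ i → at c (len c ∸ i)) (len c)
    linked i i< rewrite ∸≡suc∸suc i< =
      R-sym (steps c (len c ∸ suc i) (subst (_≤ len c) (∸≡suc∸suc i<) (m∸n≤m (len c) i)))

  mapᶜ : ∀ {R R′ P P′ x y} → (∀ {a b} → P a → P b → R a b → R′ a b) → (∀ {a} → P a → P′ a) →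
    Chain R P x y → Chain R′ P′ x y
  mapᶜ f g c = chain (len c) (at c) (λ i i< → f (inside c i (<⇒≤ i<)) (inside c (suc i) i<) (steps c i i<))
    (λ i i≤ → g (inside c i i≤)) (start c) (end c)

  restrictᶜ : ∀ {R P Q x y} → (c : Chain R P x y) → AllUpTo Q (at c) (len c) → Chain R Q x y
  restrictᶜ c inQ = chain (len c) (at c) (steps c) inQ (start c) (end c)

  takeᶜ : ∀ {R P x y} → (c : Chain R P x y) → ∀ i → i ≤ len c → Chain R P x (at c i)
  takeᶜ c i i≤ = chain i (at c) (λ j j< → steps c j (<-≤-trans j< i≤)) (λ j j≤ → inside c j (≤-trans j≤ i≤))
    (start c) refl

  dropᶜ : ∀ {R P x y} → (c : Chain R P x y) → ∀ i → i ≤ len c → Chain R P (at c i) y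
  dropᶜ {R} c i i≤ = chain (len c ∸ i) (λ t → at c (i + t)) linked
    (λ j j≤ → inside c (i + j) (subst (i + j ≤_) (m+[n∸m]≡n i≤) (+-monoʳ-≤ i j≤)))
    (cong (at c) (+-identityʳ i)) (trans (cong (at c) (m+[n∸m]≡n i≤)) (end c))
    where
    linked : Linked R (λ t → at c (i + t)) (len c ∸ i)
    linked j j< = subst (λ k → R (at c (i + j)) (at c k)) (sym (+-suc i j))
      (steps c (i + j) (subst (i + j <_) (m+[n∸m]≡n i≤) (+-monoʳ-< i j<)))

  startAtᶜ : ∀ {R P x x′ y} → x ≡ x′ → Chain R P x y → Chain R P x′ y
  startAtᶜ x≡x′ c = chain (len c) (at c) (steps c) (inside c) (trans (start c) x≡x′) (end c)

  endAtᶜ : ∀ {R P x y y′} → y ≡ y′ → Chain R P x y → Chain R P x y′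
  endAtᶜ y≡y′ c = chain (len c) (at c) (steps c) (inside c) (start c) (trans (end c) y≡y′)

  hasStep-++ˡ : ∀ {R P x y z} {Q} (c : Chain R P x y) (d : Chain R P y z) → HasStep Q c → HasStep Q (c ++ᶜ d)
  hasStep-++ˡ {Q = Q} c d = joinAt-someStepˡ {Q = Q} (len c) (len d) (at c) (at d)

  hasStep-++ʳ : ∀ {R P x y z} {Q} (c : Chain R P x y) (d : Chain R P y z) → HasStep Q d → HasStep Q (c ++ᶜ d)
  hasStep-++ʳ {Q = Q} c d = joinAt-someStepʳ {Q = Q} (len c) (len d) (at c) (at d) (trans (end c) (sym (start d)))

  hasStep-reverse : ∀ {R P x y} (R-sym : ∀ {a b} → R a b → R b a) {a b : A} (c : Chain R P x y) →
    HasStep (StepIs a b) c → HasStep (StepIs b a) (reverseᶜ R-sym c)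
  hasStep-reverse R-sym c (i , i< , s≡a , t≡b) =
    len c ∸ suc i , j< , trans (cong (at c) (m∸[m∸n]≡n i<)) t≡b , trans (cong (at c) j+1) s≡a
    where
    j< : len c ∸ suc i < len c
    j< = subst (_≤ len c) (∸≡suc∸suc i<) (m∸n≤m (len c) i)
    j+1 : len c ∸ suc (len c ∸ suc i) ≡ i
    j+1 = suc-injective (trans (sym (∸≡suc∸suc j<)) (m∸[m∸n]≡n i<))

module LazyWalks {N : ℕ} (a : Fin N → Fin N → Bool) where

  -- a weak homomorphism may collapse an edge, so a step may also stay put
  LazyStep : Fin N → Fin N → Set
  LazyStep x y = x ≡ y ⊎ a x y ≡ true

  LazyWalk : Fin N → Fin N → Set
  LazyWalk = Chain LazyStep U

  LazyWalkOf : ℕ → Fin N → Fin N → Set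
  LazyWalkOf k u v = Σ (LazyWalk u v) λ p → len p ≡ k

  reach≤-sound : ∀ k u v → reach≤ a k u v ≡ true → LazyWalkOf k u v
  reach≤-sound zero u v r with ⌊≟⌋≡true⇒≡ u v r
  ... | refl = nilᶜ tt , refl
  reach≤-sound (suc k) u v r with ∨≡true⇒ (reach≤ a k u v) r
  ... | inj₁ r′ with reach≤-sound k u v r′
  ...   | p , p≡k = p ++ᶜ stepᶜ tt tt (inj₁ refl) , trans (cong (_+ 1) p≡k) (+-comm k 1)
  reach≤-sound (suc k) u v r | inj₂ r′ with anyFin-true⇒ _ r′
  ...   | z , q with ∧≡true⇒ (reach≤ a k u z) q
  ...     | u⇝z , z→v with reach≤-sound k u z u⇝z
  ...       | p , p≡k = p ++ᶜ stepᶜ tt tt (inj₂ z→v) , trans (cong (_+ 1) p≡k) (+-comm k 1)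

  reach≤-linked : ∀ k (f : ℕ → Fin N) → Linked LazyStep f k → reach≤ a k (f 0) (f k) ≡ true
  reach≤-linked zero f _ = ⌊≟⌋-refl (f 0)
  reach≤-linked (suc k) f linked with linked k ≤-refl
  ... | inj₁ stay rewrite sym stay = ∨≡trueˡ _ (reach≤-linked k f (λ i i< → linked i (m<n⇒m<1+n i<)))
  ... | inj₂ edge = ∨≡trueʳ (reach≤ a k (f 0) (f (suc k)))
                      (anyFin-true _ (f k) (∧≡true (reach≤-linked k f (λ i i< → linked i (m<n⇒m<1+n i<))) edge))

  reach≤-complete : ∀ {u v} (p : LazyWalk u v) → reach≤ a (len p) u v ≡ true
  reach≤-complete p with reach≤-linked (len p) (at p) (steps p)
  ... | r rewrite start p | end p = r

  skipLoop : ∀ {u v} (p : LazyWalk u v) i j → i < j → j ≤ len p → at p i ≡ at p j →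
    LazyWalkOf (i + (len p ∸ j)) u v
  skipLoop p i j i<j j≤ loop = takeᶜ p i (<⇒≤ (<-≤-trans i<j j≤)) ++ᶜ startAtᶜ (sym loop) (dropᶜ p j j≤) , refl

  skipLoop-shorter : ∀ i j l → i < j → j ≤ l → i + (l ∸ j) < l
  skipLoop-shorter i j l i<j j≤l = subst (i + (l ∸ j) <_) (m+[n∸m]≡n j≤l) (+-monoˡ-< (l ∸ j) i<j)

  -- a walk with at least N steps repeats a vertex (pigeonhole), so a loop can be cut out
  shorten : ∀ {u v} (p : LazyWalk u v) → Σ (LazyWalk u v) λ q → len q < N
  shorten p = go (suc (len p)) p ≤-refl
    where
    go : ∀ fuel {u v} (p : LazyWalk u v) → len p < fuel → Σ (LazyWalk u v) λ q → len q < N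
    go (suc fuel) p (s≤s p≤) with len p <? N
    ... | yes p<N = p , p<N
    ... | no p≮N with pigeonhole (s≤s (≮⇒≥ p≮N)) (λ (x : Fin (suc (len p))) → at p (toℕ x))
    ...   | i , j , i<j , loop with skipLoop p (toℕ i) (toℕ j) i<j (≤-pred (toℕ<n j)) loop
    ...     | q , q≡ = go fuel q (≤-trans (≤-reflexive (cong suc q≡))
                         (≤-trans (skipLoop-shorter (toℕ i) (toℕ j) (len p) i<j (≤-pred (toℕ<n j))) p≤))

  idle : ∀ m v → LazyWalkOf m v v
  idle m v = chain m (λ _ → v) (λ _ _ → inj₁ refl) (λ _ _ → tt) refl refl , refl

  padTo : ∀ {u v} (p : LazyWalk u v) K → len p ≤ K → LazyWalkOf K u v
  padTo {v = v} p K p≤K = p ++ᶜ proj₁ (idle (K ∸ len p) v) , m+[n∸m]≡n p≤K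

  walk⇒reach≤N : ∀ {u v} → LazyWalk u v → reach≤ a N u v ≡ true
  walk⇒reach≤N p with shorten p
  ... | q , q<N with padTo q N (<⇒≤ q<N)
  ...   | r , r≡N = subst (λ k → reach≤ a k _ _ ≡ true) r≡N (reach≤-complete r)

  -- `dist` of Defs for a bare adjacency relation: `dist G` is definitionally `distance (adj G)`
  distance : Fin N → Fin N → ℕ
  distance u v = search (λ k → reach≤ a k u v) 0 N

  distance≤len : ∀ {u v} (p : LazyWalk u v) → distance u v ≤ len p
  distance≤len p = search-≤-hit _ 0 N (len p) (reach≤-complete p) z≤n

  geodesic : ∀ {u v} → LazyWalk u v → LazyWalkOf (distance u v) u v
  geodesic {u} {v} p with shorten p
  ... | q , q<N = reach≤-sound (distance u v) u v (search-hit _ 0 N (≤-<-trans (distance≤len q) q<N))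

  distance-refl : ∀ u → distance u u ≡ 0
  distance-refl u = n≤0⇒n≡0 (distance≤len (nilᶜ {R = LazyStep} {P = U} tt))

  distance≡0⇒≡ : ∀ u v → distance u v ≡ 0 → u ≡ v
  distance≡0⇒≡ u v d≡0 = ⌊≟⌋≡true⇒≡ u v (subst (λ k → reach≤ a k u v ≡ true) d≡0
    (search-hit _ 0 N (subst (_< N) (sym d≡0) (≤-trans (s≤s z≤n) (toℕ<n u)))))

  ≢⇒1≤distance : ∀ {u v} → u ≢ v → 1 ≤ distance u v
  ≢⇒1≤distance {u} {v} u≢v with distance u v in d
  ... | zero = contradiction (distance≡0⇒≡ u v d) u≢v
  ... | suc _ = s≤s z≤n

  distance-triangle : ∀ {u v x} → LazyWalk u v → LazyWalk v x → distance u x ≤ distance u v + distance v x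
  distance-triangle p q with geodesic p | geodesic q
  ... | p′ , p′≡ | q′ , q′≡ = ≤-trans (distance≤len (p′ ++ᶜ q′)) (≤-reflexive (cong₂ _+_ p′≡ q′≡))

  geodesic-injective : ∀ {u v} (q : LazyWalk u v) → len q ≡ distance u v →
    ∀ i j → i < j → j ≤ len q → at q i ≢ at q j
  geodesic-injective {u} {v} q q≡ i j i<j j≤ loop = <⇒≱ (skipLoop-shorter i j (len q) i<j j≤)
    (≤-trans (≤-reflexive q≡) (≤-trans (distance≤len (proj₁ short)) (≤-reflexive (proj₂ short))))
    where
    short : LazyWalkOf (i + (len q ∸ j)) u v
    short = skipLoop q i j i<j j≤ loop

  module Symmetric (a-sym : ∀ x y → a x y ≡ a y x) where

    lazyStep-sym : ∀ {x y} → LazyStep x y → LazyStep y x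
    lazyStep-sym (inj₁ x≡y) = inj₁ (sym x≡y)
    lazyStep-sym {x} {y} (inj₂ edge) = inj₂ (trans (a-sym y x) edge)

    reverseʷ : ∀ {P} {u v} → Chain LazyStep P u v → Chain LazyStep P v u
    reverseʷ = reverseᶜ lazyStep-sym

    distance-sym≤ : ∀ {u v} → LazyWalk v u → distance u v ≤ distance v u
    distance-sym≤ p = ≤-trans (distance≤len (reverseʷ (proj₁ (geodesic p)))) (≤-reflexive (proj₂ (geodesic p)))

    distance-sym : ∀ {u v} → LazyWalk v u → distance u v ≡ distance v u
    distance-sym p = ≤-antisym (distance-sym≤ p) (distance-sym≤ (reverseʷ p))

-- Components of G - v, triods and tours

module GraphWalks (G : Graph) where
  open LazyWalks (adj G) public
  open Symmetric (adj-sym G) public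

  walk⇒lazyWalk : ∀ {u v k} → Walk G u v k → LazyWalk u v
  walk⇒lazyWalk here = nilᶜ tt
  walk⇒lazyWalk (step e r) = stepᶜ tt tt (inj₂ e) ++ᶜ walk⇒lazyWalk r

  edge-sym : ∀ {x y} → Edge G x y → Edge G y x
  edge-sym {x} {y} e = trans (adj-sym G y x) e

  edge⇒≢ : ∀ {x y} → Edge G x y → x ≢ y
  edge⇒≢ {x} e refl = true≢false (trans (sym e) (irrefl G x))

module Components (G : Graph) where
  open GraphWalks G public

  module Minus (v : V G) = LazyWalks (adjMinus G v)

  adjMinus-sym : ∀ v x y → adjMinus G v x y ≡ adjMinus G v y x
  adjMinus-sym v x y rewrite adj-sym G x y = cong (adj G y x ∧_) (∧-comm (x ≢ᵇ v) (y ≢ᵇ v))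

  adjMinus≡true⇒ : ∀ {v x y} → adjMinus G v x y ≡ true → Edge G x y × x ≢ v × y ≢ v
  adjMinus≡true⇒ {v} {x} {y} e with ∧≡true⇒ (adj G x y) e
  ... | x~y , rest with ∧≡true⇒ (x ≢ᵇ v) rest
  ...   | x≢v , y≢v = x~y , ≢ᵇ≡true⇒≢ x v x≢v , ≢ᵇ≡true⇒≢ y v y≢v

  adjMinus≡true : ∀ {v x y} → Edge G x y → x ≢ v → y ≢ v → adjMinus G v x y ≡ true
  adjMinus≡true {v} {x} {y} x~y x≢v y≢v = ∧≡true x~y (∧≡true (≢⇒≢ᵇ≡true x v x≢v) (≢⇒≢ᵇ≡true y v y≢v))

  SameComp : V G → V G → V G → Set
  SameComp v = Minus.LazyWalk v

  SameComp-refl : ∀ {v x} → SameComp v x x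
  SameComp-refl = nilᶜ tt

  SameComp-sym : ∀ {v x y} → SameComp v x y → SameComp v y x
  SameComp-sym {v} = Minus.Symmetric.reverseʷ v (adjMinus-sym v)

  SameComp-trans : ∀ {v x y z} → SameComp v x y → SameComp v y z → SameComp v x z
  SameComp-trans = _++ᶜ_

  SameComp⇒sameComp : ∀ {v x y} → SameComp v x y → sameComp G v x y ≡ true
  SameComp⇒sameComp {v} = Minus.walk⇒reach≤N v

  sameComp⇒SameComp : ∀ {v x y} → sameComp G v x y ≡ true → SameComp v x y
  sameComp⇒SameComp {v} {x} {y} e = proj₁ (Minus.reach≤-sound v (n G) x y e)

  SameComp-edge : ∀ {v x y} → Edge G x y → x ≢ v → y ≢ v → SameComp v x y
  SameComp-edge x~y x≢v y≢v = stepᶜ tt tt (inj₂ (adjMinus≡true x~y x≢v y≢v))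

  SameComp⇒lazyWalk : ∀ {v x y} → SameComp v x y → LazyWalk x y
  SameComp⇒lazyWalk = mapᶜ (λ _ _ → λ { (inj₁ x≡y) → inj₁ x≡y ; (inj₂ e) → inj₂ (proj₁ (adjMinus≡true⇒ e)) })
                           (λ t → t)

  SameComp-avoids : ∀ {v x y} (p : SameComp v x y) → x ≢ v → ∀ i → i ≤ len p → at p i ≢ v
  SameComp-avoids p x≢v zero _ = subst (_≢ _) (sym (start p)) x≢v
  SameComp-avoids p x≢v (suc i) i< with steps p i i<
  ... | inj₁ stay = subst (_≢ _) stay (SameComp-avoids p x≢v i (<⇒≤ i<))
  ... | inj₂ e = proj₂ (proj₂ (adjMinus≡true⇒ e))

  avoiding⇒SameComp : ∀ {v x y} (p : LazyWalk x y) → (∀ i → i ≤ len p → at p i ≢ v) → SameComp v x y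
  avoiding⇒SameComp {v} p avoids = mapᶜ {P = _≢ v}
    (λ a≢v b≢v → λ { (inj₁ a≡b) → inj₁ a≡b ; (inj₂ e) → inj₂ (adjMinus≡true e a≢v b≢v) }) (λ _ → tt)
    (restrictᶜ p avoids)

  SameComp-≢ : ∀ {v x y} → SameComp v x y → x ≢ v → y ≢ v
  SameComp-≢ p x≢v = subst (_≢ _) (end p) (SameComp-avoids p x≢v (len p) ≤-refl)

  passesThrough : ∀ {v x z} (p : LazyWalk x z) → ¬ SameComp v x z → ∃ λ i → i ≤ len p × at p i ≡ v
  passesThrough {v} p x≁z with anyUpTo? (λ i → at p i ≟ᶠ v) (suc (len p))
  ... | yes (i , s≤s i≤ , hit) = i , i≤ , hit
  ... | no miss = contradiction (avoiding⇒SameComp p λ i i≤ hit → miss (i , s≤s i≤ , hit)) x≁z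

  Outside : V G → V G → V G → Set
  Outside v a y = y ≡ v ⊎ ¬ SameComp v a y

  outside? : ∀ v a y → Dec (Outside v a y)
  outside? v a y with y ≟ᶠ v | sameComp G v a y in same
  ... | yes y≡v | _ = yes (inj₁ y≡v)
  ... | no y≢v | true = no λ { (inj₁ y≡v) → y≢v y≡v ; (inj₂ a≁y) → a≁y (sameComp⇒SameComp same) }
  ... | no _ | false = yes (inj₂ λ a~y → true≢false (trans (sym (SameComp⇒sameComp a~y)) same))

  ¬outside⇒ : ∀ {v a y} → ¬ Outside v a y → y ≢ v × SameComp v a y
  ¬outside⇒ {v} {a} {y} inside with y ≟ᶠ v | sameComp G v a y in same
  ... | yes y≡v | _ = contradiction (inj₁ y≡v) inside
  ... | no y≢v | true = y≢v , sameComp⇒SameComp same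
  ... | no _ | false = contradiction (inj₂ λ a~y → true≢false (trans (sym (SameComp⇒sameComp a~y)) same)) inside

  inside⇒outside : ∀ {v a b u} → ¬ SameComp v a b → SameComp v a u → Outside v b u
  inside⇒outside a≁b a~u = inj₂ λ b~u → a≁b (SameComp-trans a~u (SameComp-sym b~u))

  edge-inside⇒outside : ∀ {v a b y y′} → ¬ SameComp v a b → y ≢ v × SameComp v a y → Edge G y y′ → Outside v b y′
  edge-inside⇒outside {v} {y′ = y′} a≁b (y≢v , a~y) e with y′ ≟ᶠ v
  ... | yes y′≡v = inj₁ y′≡v
  ... | no y′≢v = inside⇒outside a≁b (SameComp-trans a~y (SameComp-edge e y≢v y′≢v))

  -- an edge of G - v lies inside a single component
  edge-outside-either : ∀ {v a b} → ¬ SameComp v a b → ∀ y y′ → Edge G y y′ →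
    (Outside v a y × Outside v a y′) ⊎ (Outside v b y × Outside v b y′)
  edge-outside-either {v} {a} a≁b y y′ e with outside? v a y | outside? v a y′
  ... | yes out | yes out′ = inj₁ (out , out′)
  ... | no inside | _ =
    inj₂ (inside⇒outside a≁b (proj₂ (¬outside⇒ inside)) , edge-inside⇒outside a≁b (¬outside⇒ inside) e)
  ... | yes _ | no inside′ =
    inj₂ (edge-inside⇒outside a≁b (¬outside⇒ inside′) (edge-sym e) , inside⇒outside a≁b (proj₂ (¬outside⇒ inside′)))

  lastBeforeSeq : ∀ {P : V G → Set} v k (f : ℕ → V G) → Linked LazyStep f k → AllUpTo P f k →
    f k ≡ v → f 0 ≢ v → Σ (V G) λ y → P y × Edge G y v × Chain (Minus.LazyStep v) P (f 0) y
  lastBeforeSeq v zero f _ _ hit f0≢v = contradiction hit f0≢v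
  lastBeforeSeq {P} v (suc k) f linked inP hit f0≢v with f 1 ≟ᶠ v
  ... | yes f1≡v with linked 0 z<s
  ...   | inj₁ f0≡f1 = contradiction (trans f0≡f1 f1≡v) f0≢v
  ...   | inj₂ e = f 0 , inP 0 z≤n , subst (Edge G (f 0)) f1≡v e , nilᶜ (inP 0 z≤n)
  lastBeforeSeq {P} v (suc k) f linked inP hit f0≢v | no f1≢v
    with lastBeforeSeq {P} v k (f ∘ suc) (λ i i< → linked (suc i) (s≤s i<)) (λ i i≤ → inP (suc i) (s≤s i≤)) hit f1≢v
  ... | y , py , y~v , rest = y , py , y~v , stepᶜ (inP 0 z≤n) (inP 1 (s≤s z≤n)) first ++ᶜ rest
    where
    first : Minus.LazyStep v (f 0) (f 1)
    first with linked 0 z<s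
    ... | inj₁ f0≡f1 = inj₁ f0≡f1
    ... | inj₂ e = inj₂ (adjMinus≡true e f0≢v f1≢v)

  lastBefore : ∀ {P : V G → Set} {x v} → Chain LazyStep P x v → x ≢ v →
    Σ (V G) λ y → P y × Edge G y v × Chain (Minus.LazyStep v) P x y
  lastBefore {P} {x} {v} p x≢v
    with lastBeforeSeq {P} v (len p) (at p) (steps p) (inside p) (end p) (subst (_≢ v) (sym (start p)) x≢v)
  ... | y , py , y~v , q = y , py , y~v , startAtᶜ (start p) q

  closeCycle : ∀ v d (f : ℕ → V G) → (∀ i j → i < j → j ≤ suc d → f i ≢ f j) →
    (∀ t → t < suc d → Edge G (f t) (f (suc t))) → (∀ t → t ≤ suc d → f t ≢ v) →
    Edge G (f (suc d)) v → Edge G v (f 0) → Cycle G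
  closeCycle v d f f-inj f-edge f≢v last first =
    record { k = d ; c = c ; inj = c-inj ; consec = c-consec ; close = c-close }
    where
    c : Fin (suc (suc (suc d))) → V G
    c i = if toℕ i ≤ᵇ suc d then f (toℕ i) else v

    c-≤ : ∀ i → toℕ i ≤ suc d → c i ≡ f (toℕ i)
    c-≤ i i≤ rewrite ≤⇒≤ᵇ≡true i≤ = refl

    c-> : ∀ i → suc d < toℕ i → c i ≡ v
    c-> i i> rewrite >⇒≤ᵇ≡false i> = refl

    top : ∀ (i : Fin (suc (suc (suc d)))) → ¬ (toℕ i ≤ suc d) → toℕ i ≡ suc (suc d)
    top i i≰ = ≤-antisym (≤-pred (toℕ<n i)) (≰⇒> i≰)

    f-inj′ : ∀ i j → i ≤ suc d → j ≤ suc d → f i ≡ f j → i ≡ j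
    f-inj′ i j i≤ j≤ fi≡fj with <-cmp i j
    ... | tri< i<j _ _ = contradiction fi≡fj (f-inj i j i<j j≤)
    ... | tri≈ _ i≡j _ = i≡j
    ... | tri> _ _ j<i = contradiction (sym fi≡fj) (f-inj j i j<i i≤)

    c-inj : ∀ i j → c i ≡ c j → i ≡ j
    c-inj i j ci≡cj with toℕ i ≤? suc d | toℕ j ≤? suc d
    ... | yes i≤ | yes j≤ = toℕ-injective (f-inj′ _ _ i≤ j≤ (trans (sym (c-≤ i i≤)) (trans ci≡cj (c-≤ j j≤))))
    ... | yes i≤ | no j≰ = contradiction (trans (sym (c-≤ i i≤)) (trans ci≡cj (c-> j (≰⇒> j≰)))) (f≢v _ i≤)
    ... | no i≰ | yes j≤ = contradiction (trans (sym (c-≤ j j≤)) (trans (sym ci≡cj) (c-> i (≰⇒> i≰)))) (f≢v _ j≤)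
    ... | no i≰ | no j≰ = toℕ-injective (trans (top i i≰) (sym (top j j≰)))

    c-consec : ∀ (i : Fin (suc (suc d))) → Edge G (c (inject₁ i)) (c (suc i))
    c-consec i with m≤n⇒m<n∨m≡n (≤-pred (toℕ<n i))
    ... | inj₁ i< rewrite c-≤ (inject₁ i) (≤-trans (≤-reflexive (toℕ-inject₁ i)) (<⇒≤ i<))
                        | c-≤ (suc i) i< | toℕ-inject₁ i = f-edge (toℕ i) i<
    ... | inj₂ i≡ rewrite c-≤ (inject₁ i) (≤-reflexive (trans (toℕ-inject₁ i) i≡))
                        | c-> (suc i) (≤-reflexive (cong suc (sym i≡))) | toℕ-inject₁ i | i≡ = last

    c-close : Edge G (c (fromℕ (suc (suc d)))) (c zero)
    c-close rewrite c-> (fromℕ (suc (suc d))) (≤-reflexive (sym (toℕ-fromℕ (suc (suc d))))) = first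

  -- a shortest walk in G - v between two neighbours of v closes up to a cycle through v
  neighbours-joined⇒cycle : ∀ {v x y} → Edge G x v → Edge G y v → x ≢ y → SameComp v x y → Cycle G
  neighbours-joined⇒cycle {v} {x} {y} x~v y~v x≢y p with Minus.geodesic v p
  ... | q , q-shortest = close (len q) refl
    where
    close : ∀ l → len q ≡ l → Cycle G
    close zero q≡0 = contradiction (trans (sym (start q)) (trans (cong (at q) (sym q≡0)) (end q))) x≢y
    close (suc d) q≡ = closeCycle v d (at q) q-inj q-edge q≢v last first
      where
      ≤len : ∀ {j} → j ≤ suc d → j ≤ len q
      ≤len = subst (_ ≤_) (sym q≡)
      q-inj : ∀ i j → i < j → j ≤ suc d → at q i ≢ at q j
      q-inj i j i<j j≤ = Minus.geodesic-injective v q q-shortest i j i<j (≤len j≤)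
      q-edge : ∀ t → t < suc d → Edge G (at q t) (at q (suc t))
      q-edge t t< with steps q t (≤len t<)
      ... | inj₁ stay = contradiction stay (q-inj t (suc t) ≤-refl t<)
      ... | inj₂ e = proj₁ (adjMinus≡true⇒ e)
      q≢v : ∀ t → t ≤ suc d → at q t ≢ v
      q≢v t t≤ = SameComp-avoids q (edge⇒≢ x~v) t (≤len t≤)
      last : Edge G (at q (suc d)) v
      last = subst (λ z → Edge G z v) (sym (trans (cong (at q) (sym q≡)) (end q))) y~v
      first : Edge G v (at q 0)
      first = subst (Edge G v) (sym (start q)) (edge-sym x~v)

  isRep-true : ∀ v z → z ≢ v → anyFin (λ u → (toℕ u <ᵇ toℕ z) ∧ (u ≢ᵇ v) ∧ sameComp G v u z) ≡ false →
    isRep G v z ≡ true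
  isRep-true v z z≢v none = ∧≡true (≢⇒≢ᵇ≡true z v z≢v) (not≡true none)

  -- descend to ever smaller indices in the component until the least one
  representative : ∀ v z → z ≢ v → Σ (V G) λ r → isRep G v r ≡ true × SameComp v r z
  representative v z z≢v = go (suc (toℕ z)) z ≤-refl z≢v
    where
    go : ∀ fuel z → toℕ z < fuel → z ≢ v → Σ (V G) λ r → isRep G v r ≡ true × SameComp v r z
    go (suc fuel) z (s≤s z<) z≢v with anyFin (λ u → (toℕ u <ᵇ toℕ z) ∧ (u ≢ᵇ v) ∧ sameComp G v u z) in smaller
    ... | false = z , isRep-true v z z≢v smaller , SameComp-refl
    ... | true with anyFin-true⇒ _ smaller
    ...   | u , q with ∧≡true⇒ (toℕ u <ᵇ toℕ z) q
    ...     | u<z , q′ with ∧≡true⇒ (u ≢ᵇ v) q′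
    ...       | u≢v , u~z with go fuel u (≤-trans (<ᵇ≡true⇒< _ _ u<z) z<) (≢ᵇ≡true⇒≢ u v u≢v)
    ...         | r , rep , r~u = r , rep , SameComp-trans r~u (sameComp⇒SameComp u~z)

  isRep⇒≢ : ∀ v r → isRep G v r ≡ true → r ≢ v
  isRep⇒≢ v r rep = ≢ᵇ≡true⇒≢ r v (proj₁ (∧≡true⇒ (r ≢ᵇ v) rep))

  isRep-minimal : ∀ v r u → isRep G v r ≡ true → toℕ u < toℕ r → u ≢ v → ¬ SameComp v u r
  isRep-minimal v r u rep u<r u≢v u~r = true≢false (trans
    (sym (anyFin-true _ u (∧≡true (<⇒<ᵇ≡true u<r) (∧≡true (≢⇒≢ᵇ≡true u v u≢v) (SameComp⇒sameComp u~r)))))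
    (not≡true⇒ _ (proj₂ (∧≡true⇒ (r ≢ᵇ v) rep))))

  isRep-unique : ∀ v r₁ r₂ → isRep G v r₁ ≡ true → isRep G v r₂ ≡ true → SameComp v r₁ r₂ → r₁ ≡ r₂
  isRep-unique v r₁ r₂ rep₁ rep₂ r₁~r₂ with <-cmp (toℕ r₁) (toℕ r₂)
  ... | tri< r₁<r₂ _ _ = contradiction r₁~r₂ (isRep-minimal v r₂ r₁ rep₂ r₁<r₂ (isRep⇒≢ v r₁ rep₁))
  ... | tri≈ _ r₁≡r₂ _ = toℕ-injective r₁≡r₂
  ... | tri> _ _ r₂<r₁ = contradiction (SameComp-sym r₁~r₂) (isRep-minimal v r₁ r₂ rep₁ r₂<r₁ (isRep⇒≢ v r₂ rep₂))

  ≤-reachComp : ∀ v u x → SameComp v u x → x ≢ v → dist G v x ≤ reachComp G v u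
  ≤-reachComp v u x u~x x≢v = subst (_≤ reachComp G v u) term (≤-maxFin _ x)
    where
    term : (if (x ≢ᵇ v) ∧ sameComp G v u x then dist G v x else 0) ≡ dist G v x
    term rewrite ≢⇒≢ᵇ≡true x v x≢v | SameComp⇒sameComp u~x = refl

  ≤-reachComp⇒ : ∀ v u {h} → 1 ≤ h → h ≤ reachComp G v u →
    Σ (V G) λ x → x ≢ v × SameComp v u x × h ≤ dist G v x
  ≤-reachComp⇒ v u {h} 1≤h h≤ with ≤-maxFin⇒ _ 1≤h h≤
  ... | x , h≤x with (x ≢ᵇ v) ∧ sameComp G v u x in inComp
  ...   | false = contradiction h≤x (<⇒≱ 1≤h)
  ...   | true with ∧≡true⇒ (x ≢ᵇ v) inComp
  ...     | x≢v , u~x = x , ≢ᵇ≡true⇒≢ x v x≢v , sameComp⇒SameComp u~x , h≤x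

  reachesAtLeast : V G → ℕ → V G → Bool
  reachesAtLeast v h r = isRep G v r ∧ (h ≤ᵇ reachComp G v r)

  ≤eta⇔ : ∀ v h → 1 ≤ h → h ≤ eta G v ⇔ (3 ≤ degree G v × 3 ≤ countFin (reachesAtLeast v h))
  ≤eta⇔ v h 1≤h with 3 ≤ᵇ degree G v in deg
  ... | false = mk⇔ (λ h≤0 → contradiction h≤0 (<⇒≱ 1≤h))
                    (λ (3≤deg , _) → contradiction (trans (sym (≤⇒≤ᵇ≡true 3≤deg)) deg) true≢false)
  ... | true = mk⇔
    (λ h≤ → ≤ᵇ≡true⇒≤ 3 _ deg , subst (3 ≤_) counts (Equivalence.to (≤thirdLargest⇔ h reaches 1≤h) h≤))
    (λ (_ , 3≤) → Equivalence.from (≤thirdLargest⇔ h reaches 1≤h) (subst (3 ≤_) (sym counts) 3≤))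
    where
    reaches : List ℕ
    reaches = map (reachComp G v) (filterFin (isRep G v))
    counts : countGE h reaches ≡ countFin (reachesAtLeast v h)
    counts = countGE-map-filterFin (isRep G v) (reachComp G v) h

  FarFrom : V G → ℕ → V G → Set
  FarFrom v h a = a ≢ v × h ≤ dist G v a

  record Triod (v : V G) (h : ℕ) : Set where
    field
      a₁ a₂ a₃ : V G
      far₁ : FarFrom v h a₁
      far₂ : FarFrom v h a₂
      far₃ : FarFrom v h a₃
      apart₁₂ : ¬ SameComp v a₁ a₂
      apart₁₃ : ¬ SameComp v a₁ a₃
      apart₂₃ : ¬ SameComp v a₂ a₃

  ≤eta⇒triod : ∀ v h → 1 ≤ h → h ≤ eta G v → Triod v h
  ≤eta⇒triod v h 1≤h h≤
    with 3≤countFin⇒ _ (proj₂ (Equivalence.to (≤eta⇔ v h 1≤h) h≤))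
  ... | r₁ , r₂ , r₃ , r₁≢r₂ , r₁≢r₃ , r₂≢r₃ , big₁ , big₂ , big₃ = record
    { a₁ = proj₁ (tip big₁) ; a₂ = proj₁ (tip big₂) ; a₃ = proj₁ (tip big₃)
    ; far₁ = proj₁ (proj₂ (tip big₁)) ; far₂ = proj₁ (proj₂ (tip big₂)) ; far₃ = proj₁ (proj₂ (tip big₃))
    ; apart₁₂ = apart big₁ big₂ r₁≢r₂
    ; apart₁₃ = apart big₁ big₃ r₁≢r₃
    ; apart₂₃ = apart big₂ big₃ r₂≢r₃ }
    where
    tip : ∀ {r} → reachesAtLeast v h r ≡ true → Σ (V G) λ x → FarFrom v h x × SameComp v r x
    tip {r} big with ≤-reachComp⇒ v r 1≤h (≤ᵇ≡true⇒≤ _ _ (proj₂ (∧≡true⇒ (isRep G v r) big)))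
    ... | x , x≢v , r~x , h≤ = x , (x≢v , h≤) , r~x
    apart : ∀ {r r′} (big : reachesAtLeast v h r ≡ true) (big′ : reachesAtLeast v h r′ ≡ true) → r ≢ r′ →
      ¬ SameComp v (proj₁ (tip big)) (proj₁ (tip big′))
    apart {r} {r′} big big′ r≢r′ x~x′ = r≢r′ (isRep-unique v r r′
      (proj₁ (∧≡true⇒ (isRep G v r) big)) (proj₁ (∧≡true⇒ (isRep G v r′) big′))
      (SameComp-trans (proj₂ (proj₂ (tip big))) (SameComp-trans x~x′ (SameComp-sym (proj₂ (proj₂ (tip big′)))))))

module TreeProperties (T : Graph) (isT : IsTree T) where
  open Components T public

  connecting : ∀ (u v : V T) → LazyWalk u v
  connecting u v = walk⇒lazyWalk (proj₂ (proj₂ (proj₁ isT) u v))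

  dist-sym : ∀ u v → dist T u v ≡ dist T v u
  dist-sym u v = distance-sym (connecting v u)

  dist-triangle : ∀ u v x → dist T u x ≤ dist T u v + dist T v x
  dist-triangle u v x = distance-triangle (connecting u v) (connecting v x)

  neighbours-separated : ∀ {v x y} → Edge T x v → Edge T y v → x ≢ y → ¬ SameComp v x y
  neighbours-separated x~v y~v x≢y x~y = proj₂ isT (neighbours-joined⇒cycle x~v y~v x≢y x~y)

  neighbourInComponent : ∀ v x → x ≢ v → Σ (V T) λ y → Edge T y v × SameComp v x y
  neighbourInComponent v x x≢v with lastBefore {P = U} (connecting x v) x≢v
  ... | y , _ , y~v , x~y = y , y~v , x~y

  -- a shortest walk between different components of T - v passes through v
  dist-through : ∀ v x z → ¬ SameComp v x z → dist T x v + dist T v z ≤ dist T x z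
  dist-through v x z x≁z with geodesic (connecting x z)
  ... | q , q-shortest with passesThrough q x≁z
  ...   | i , i≤ , hit =
    ≤-trans (+-mono-≤ (distance≤len (endAtᶜ hit (takeᶜ q i i≤))) (distance≤len (startAtᶜ hit (dropᶜ q i i≤))))
            (≤-reflexive (trans (m+[n∸m]≡n i≤) q-shortest))

  far-from-outside : ∀ v a h → h ≤ dist T v a → ∀ y → Outside v a y → h ≤ dist T y a × h ≤ dist T a y
  far-from-outside v a h h≤ y (inj₁ refl) = h≤ , subst (h ≤_) (dist-sym v a) h≤
  far-from-outside v a h h≤ y (inj₂ a≁y) =
    ≤-trans h≤ (≤-trans (m≤n+m _ _) (dist-through v y a (a≁y ∘ SameComp-sym))) ,
    ≤-trans h≤ (≤-trans (≤-reflexive (dist-sym v a)) (≤-trans (m≤m+n _ _) (dist-through v a y a≁y)))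

  triod⇒3≤degree : ∀ {v h} → Triod v h → 3 ≤ degree T v
  triod⇒3≤degree {v} t = ⇒3≤countFin (adj T v) (y far₁) (y far₂) (y far₃)
    (distinct far₁ far₂ apart₁₂) (distinct far₁ far₃ apart₁₃) (distinct far₂ far₃ apart₂₃)
    (edge-sym (y~v far₁)) (edge-sym (y~v far₂)) (edge-sym (y~v far₃))
    where
    open Triod t
    y : ∀ {a h} → FarFrom v h a → V T
    y {a} far = proj₁ (neighbourInComponent v a (proj₁ far))
    y~v : ∀ {a h} (far : FarFrom v h a) → Edge T (y far) v
    y~v {a} far = proj₁ (proj₂ (neighbourInComponent v a (proj₁ far)))
    distinct : ∀ {a a′ h} (far : FarFrom v h a) (far′ : FarFrom v h a′) → ¬ SameComp v a a′ → y far ≢ y far′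
    distinct {a} {a′} far far′ a≁a′ y≡y′ = a≁a′ (SameComp-trans (proj₂ (proj₂ (neighbourInComponent v a (proj₁ far))))
      (subst (λ z → SameComp v z a′) (sym y≡y′) (SameComp-sym (proj₂ (proj₂ (neighbourInComponent v a′ (proj₁ far′)))))))

  triod⇒≤eta : ∀ {v h} → 1 ≤ h → Triod v h → h ≤ eta T v
  triod⇒≤eta {v} {h} 1≤h t = Equivalence.from (≤eta⇔ v h 1≤h) (triod⇒3≤degree t ,
    ⇒3≤countFin _ (rep far₁) (rep far₂) (rep far₃)
      (distinct far₁ far₂ apart₁₂) (distinct far₁ far₃ apart₁₃) (distinct far₂ far₃ apart₂₃)
      (big far₁) (big far₂) (big far₃))
    where
    open Triod t
    rep : ∀ {a} → FarFrom v h a → V T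
    rep {a} far = proj₁ (representative v a (proj₁ far))
    rep~a : ∀ {a} (far : FarFrom v h a) → SameComp v (rep far) a
    rep~a {a} far = proj₂ (proj₂ (representative v a (proj₁ far)))
    big : ∀ {a} (far : FarFrom v h a) → reachesAtLeast v h (rep far) ≡ true
    big {a} far = ∧≡true (proj₁ (proj₂ (representative v a (proj₁ far))))
      (≤⇒≤ᵇ≡true (≤-trans (proj₂ far) (≤-reachComp v (rep far) a (rep~a far) (proj₁ far))))
    distinct : ∀ {a a′} (far : FarFrom v h a) (far′ : FarFrom v h a′) → ¬ SameComp v a a′ → rep far ≢ rep far′
    distinct far far′ a≁a′ r≡r′ = a≁a′ (SameComp-trans (SameComp-sym (rep~a far))
      (subst (λ r → SameComp v r _) (sym r≡r′) (rep~a far′)))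

  toCentre : ∀ {v a y} → Outside v a y → Chain LazyStep (Outside v a) y v
  toCentre (inj₁ refl) = nilᶜ (inj₁ refl)
  toCentre {v} {a} {y} (inj₂ a≁y) with y ≟ᶠ v
  ... | yes refl = nilᶜ (inj₁ refl)
  ... | no y≢v with neighbourInComponent v y y≢v
  ...   | y′ , y′~v , y~y′ =
    toY′ ++ᶜ stepᶜ (subst (Outside v a) (end toY′) (inside toY′ (len toY′) ≤-refl)) (inj₁ refl) (inj₂ y′~v)
    where
    toY′ : Chain LazyStep (Outside v a) y y′
    toY′ = restrictᶜ (SameComp⇒lazyWalk y~y′)
      (λ t t≤ → inj₂ λ a~ → a≁y (SameComp-trans a~ (SameComp-sym (takeᶜ y~y′ t t≤))))

  routeOutside : ∀ {v a y y′} → Outside v a y → Outside v a y′ → Chain LazyStep (Outside v a) y y′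
  routeOutside out out′ = toCentre out ++ᶜ reverseʷ (toCentre out′)

  PartialTour : V T → V T → List (V T × V T) → V T → V T → Set
  PartialTour v a l s e = Σ (Chain LazyStep (Outside v a) s e) λ W →
    ∀ x y → (x , y) ∈ l → Edge T x y → Outside v a x → Outside v a y → HasStep (StepIs x y) W

  Tour : V T → V T → V T → V T → Set
  Tour v a s e = Σ (Chain LazyStep (Outside v a) s e) λ W →
    ∀ x y → Edge T x y → Outside v a x → Outside v a y → HasStep (StepIs x y) W

  tour-skip : ∀ {v a l s e} x y → PartialTour v a l s e → ¬ (Edge T x y × Outside v a x × Outside v a y) →
    PartialTour v a ((x , y) ∷ l) s e
  tour-skip x y (W , covers) bad = W , λ where
    _ _ (here refl) e out out′ → contradiction (e , out , out′) bad
    x′ y′ (there m) → covers x′ y′ m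

  -- go to the next listed edge outside the component of a, traverse it, and continue
  partialTour : ∀ {v} a (l : List (V T × V T)) {s e} → Outside v a s → Outside v a e → PartialTour v a l s e
  partialTour a [] out-s out-e = routeOutside out-s out-e , λ _ _ ()
  partialTour {v} a ((x , y) ∷ l) {s} {e} out-s out-e with adj T x y in x~y | outside? v a x | outside? v a y
  ... | true | yes out-x | yes out-y = W₁ ++ᶜ W₂ ++ᶜ W₃ , covers
    where
    W₁ : Chain LazyStep (Outside v a) s x
    W₁ = routeOutside out-s out-x
    W₂ : Chain LazyStep (Outside v a) x y
    W₂ = stepᶜ out-x out-y (inj₂ x~y)
    rest : PartialTour v a l y e
    rest = partialTour a l out-y out-e
    W₃ : Chain LazyStep (Outside v a) y e
    W₃ = proj₁ rest
    covers : ∀ x′ y′ → (x′ , y′) ∈ ((x , y) ∷ l) → Edge T x′ y′ → Outside v a x′ → Outside v a y′ →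
      HasStep (StepIs x′ y′) (W₁ ++ᶜ W₂ ++ᶜ W₃)
    covers x′ y′ (here refl) _ _ _ =
      hasStep-++ʳ {Q = StepIs x y} W₁ (W₂ ++ᶜ W₃) (hasStep-++ˡ {Q = StepIs x y} W₂ W₃ (0 , z<s , refl , refl))
    covers x′ y′ (there m) e out out′ =
      hasStep-++ʳ {Q = StepIs x′ y′} W₁ (W₂ ++ᶜ W₃)
        (hasStep-++ʳ {Q = StepIs x′ y′} W₂ W₃ (proj₂ rest x′ y′ m e out out′))
  ... | false | _ | _ = tour-skip x y (partialTour a l out-s out-e) λ (e , _) → true≢false (trans (sym e) x~y)
  ... | true | no in-x | _ = tour-skip x y (partialTour a l out-s out-e) λ (_ , out , _) → in-x out
  ... | true | yes _ | no in-y = tour-skip x y (partialTour a l out-s out-e) λ (_ , _ , out) → in-y out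

  tour : ∀ {v a s e} → Outside v a s → Outside v a e → Tour v a s e
  tour {a = a} out-s out-e with partialTour a (cartesianProduct (allFin (n T)) (allFin (n T))) out-s out-e
  ... | W , covers = W , λ x y → covers x y (∈-cartesianProduct⁺ (∈-allFin x) (∈-allFin y))

-- The spine of a diameter

maximisingPair : ∀ {N} (f : Fin N → Fin N → ℕ) → Fin N → Σ (Fin N) λ u → Σ (Fin N) λ v → ∀ x y → f x y ≤ f u v
maximisingPair f w with maxFin-attained (λ u → maxFin (f u)) w
... | u , max≡ with maxFin-attained (f u) w
...   | v , maxu≡ = u , v , λ x y → ≤-trans (≤-maxFin (f x) y)
                      (≤-trans (≤-maxFin (λ u → maxFin (f u)) x) (≤-reflexive (trans max≡ maxu≡)))

diameterEnds : (T : Graph) → IsTree T → Σ (V T) λ u₀ → Σ (V T) λ u₁ → ∀ x y → dist T x y ≤ dist T u₀ u₁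
diameterEnds T isT = maximisingPair (dist T) (fromℕ< (proj₁ (proj₁ isT)))

module Diameter (T : Graph) (isT : IsTree T) (u₀ u₁ : V T) (longest : ∀ x y → dist T x y ≤ dist T u₀ u₁) where
  open TreeProperties T isT public

  L : ℕ
  L = dist T u₀ u₁

  private
    -- abstract, so that p never unfolds into the search computing the geodesic
    abstract
      spine : LazyWalk u₀ u₁
      spine = proj₁ (geodesic (connecting u₀ u₁))

      spine-len : len spine ≡ L
      spine-len = proj₂ (geodesic (connecting u₀ u₁))

    ≤len : ∀ {i} → i ≤ L → i ≤ len spine
    ≤len = subst (_ ≤_) (sym spine-len)

  p : ℕ → V T
  p = at spine

  p0≡u₀ : p 0 ≡ u₀
  p0≡u₀ = start spine

  pL≡u₁ : p L ≡ u₁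
  pL≡u₁ = trans (cong p (sym spine-len)) (end spine)

  p-injective< : ∀ i j → i < j → j ≤ L → p i ≢ p j
  p-injective< i j i<j j≤L = geodesic-injective spine spine-len i j i<j (≤len j≤L)

  p-injective : ∀ i j → i ≤ L → j ≤ L → p i ≡ p j → i ≡ j
  p-injective i j i≤L j≤L pi≡pj with <-cmp i j
  ... | tri< i<j _ _ = contradiction pi≡pj (p-injective< i j i<j j≤L)
  ... | tri≈ _ i≡j _ = i≡j
  ... | tri> _ _ j<i = contradiction (sym pi≡pj) (p-injective< j i j<i i≤L)

  p-edge : ∀ i → i < L → Edge T (p i) (p (suc i))
  p-edge i i<L with steps spine i (≤len i<L)
  ... | inj₁ stay = contradiction stay (p-injective< i (suc i) ≤-refl i<L)
  ... | inj₂ e = e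

  dist-u₀-p≤ : ∀ i → i ≤ L → dist T u₀ (p i) ≤ i
  dist-u₀-p≤ i i≤L = distance≤len (takeᶜ spine i (≤len i≤L))

  dist-p-u₁≤ : ∀ j → j ≤ L → dist T (p j) u₁ ≤ L ∸ j
  dist-p-u₁≤ j j≤L = subst (λ l → dist T (p j) u₁ ≤ l ∸ j) spine-len (distance≤len (dropᶜ spine j (≤len j≤L)))

  p-geodesic : ∀ i j → i ≤ j → j ≤ L → j ≤ i + dist T (p i) (p j)
  p-geodesic i j i≤j j≤L = +-cancelʳ-≤ (L ∸ j) j (i + dist T (p i) (p j)) (begin
    j + (L ∸ j)                                             ≡⟨ m+[n∸m]≡n j≤L ⟩
    L                                                       ≤⟨ dist-triangle u₀ (p i) u₁ ⟩
    dist T u₀ (p i) + dist T (p i) u₁                        ≤⟨ +-monoʳ-≤ (dist T u₀ (p i))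
                                                                  (dist-triangle (p i) (p j) u₁) ⟩
    dist T u₀ (p i) + (dist T (p i) (p j) + dist T (p j) u₁) ≤⟨ +-mono-≤ (dist-u₀-p≤ i (≤-trans i≤j j≤L))
                                                                  (+-monoʳ-≤ (dist T (p i) (p j)) (dist-p-u₁≤ j j≤L)) ⟩
    i + (dist T (p i) (p j) + (L ∸ j))                        ≡⟨ sym (+-assoc i _ _) ⟩
    i + dist T (p i) (p j) + (L ∸ j)                          ∎)
    where open ≤-Reasoning

  p-edge⇒consecutive : ∀ i j → i < j → j ≤ L → Edge T (p i) (p j) → j ≡ suc i
  p-edge⇒consecutive i j i<j j≤L e =
    ≤-antisym (≤-trans (p-geodesic i j (<⇒≤ i<j) j≤L) (≤-trans (+-monoʳ-≤ i adjacent) (≤-reflexive (+-comm i 1)))) i<j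
    where
    adjacent : dist T (p i) (p j) ≤ 1
    adjacent = distance≤len (stepᶜ {R = LazyStep} {P = U} tt tt (inj₂ e))

  OnSegment : ℕ → ℕ → V T → Set
  OnSegment j l z = Σ ℕ λ c → j ≤ c × c ≤ l × z ≡ p c

  segment : ∀ j l → j ≤ l → l ≤ L → Chain LazyStep (OnSegment j l) (p j) (p l)
  segment j l j≤l l≤L = restrictᶜ (dropᶜ (takeᶜ spine l (≤len l≤L)) j j≤l)
    λ t t≤ → j + t , m≤m+n j t , subst (j + t ≤_) (m+[n∸m]≡n j≤l) (+-monoʳ-≤ j t≤) , refl

  segment-traverses : ∀ j l (j≤l : j ≤ l) (l≤L : l ≤ L) c → j ≤ c → c < l →
    HasStep (StepIs (p c) (p (suc c))) (segment j l j≤l l≤L)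
  segment-traverses j l j≤l l≤L c j≤c c<l = c ∸ j , ∸-monoˡ-< c<l j≤c ,
    cong p (m+[n∸m]≡n j≤c) , cong p (trans (+-suc j (c ∸ j)) (cong suc (m+[n∸m]≡n j≤c)))

  segment-avoids : ∀ m j l → j ≤ l → l ≤ L → m ≤ L → m < j ⊎ l < m → SameComp (p m) (p j) (p l)
  segment-avoids m j l j≤l l≤L m≤L outside =
    avoiding⇒SameComp (mapᶜ (λ _ _ s → s) (λ _ → tt) seg) avoids
    where
    seg : Chain LazyStep (OnSegment j l) (p j) (p l)
    seg = segment j l j≤l l≤L
    avoids : ∀ t → t ≤ len seg → at seg t ≢ p m
    avoids t t≤ hit with inside seg t t≤
    ... | c , j≤c , c≤l , at≡pc with p-injective c m (≤-trans c≤l l≤L) m≤L (trans (sym at≡pc) hit)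
    ...   | refl = [ (λ m<j → <⇒≱ m<j j≤c) , (λ l<m → <⇒≱ l<m c≤l) ]′ outside

  Beyond : ℕ → V T → Set
  Beyond i x = i < L × x ≢ p i × SameComp (p i) x (p (suc i))

  Before : ℕ → V T → Set
  Before zero x = ⊥
  Before (suc i) x = SameComp (p (suc i)) x (p i)

  HangsAt : ℕ → V T → Set
  HangsAt i x = x ≢ p i × ¬ Beyond i x × ¬ Before i x

  beyond? : ℕ → V T → Bool
  beyond? i x = (i <ᵇ L) ∧ (x ≢ᵇ p i) ∧ sameComp T (p i) x (p (suc i))

  beyond?≡true⇒ : ∀ i x → beyond? i x ≡ true → Beyond i x
  beyond?≡true⇒ i x b with ∧≡true⇒ (i <ᵇ L) b
  ... | i<L , b′ with ∧≡true⇒ (x ≢ᵇ p i) b′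
  ...   | x≢pi , x~pi+1 = <ᵇ≡true⇒< i L i<L , ≢ᵇ≡true⇒≢ x (p i) x≢pi , sameComp⇒SameComp x~pi+1

  beyond?≡true : ∀ i x → Beyond i x → beyond? i x ≡ true
  beyond?≡true i x (i<L , x≢pi , x~pi+1) =
    ∧≡true (<⇒<ᵇ≡true i<L) (∧≡true (≢⇒≢ᵇ≡true x (p i) x≢pi) (SameComp⇒sameComp x~pi+1))

  -- the index of the spine vertex below which x hangs
  π : V T → ℕ
  π x = search (λ i → not (beyond? i x)) 0 L

  π≤L : ∀ x → π x ≤ L
  π≤L x = search-≤ _ 0 L

  π-below : ∀ x j → j < π x → Beyond j x
  π-below x j j<π = beyond?≡true⇒ j x (not≡false⇒ _ (search-miss _ 0 L j z≤n j<π))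

  ¬beyond-π : ∀ x → ¬ Beyond (π x) x
  ¬beyond-π x beyond = true≢false (trans (sym (beyond?≡true (π x) x beyond))
    (not≡true⇒ _ (search-hit _ 0 L (proj₁ beyond))))

  π-exact : ∀ x i → i ≤ L → (∀ j → j < i → Beyond j x) → ¬ Beyond i x → π x ≡ i
  π-exact x i i≤L below ¬beyond with <-cmp (π x) i
  ... | tri< π<i _ _ = contradiction (below (π x) π<i) (¬beyond-π x)
  ... | tri≈ _ π≡i _ = π≡i
  ... | tri> _ _ i<π = contradiction (π-below x i i<π) ¬beyond

  -- such a walk reaches p i through a neighbour y ≠ p (i+1) of p i, joined to p (i+1) in T - p i via x
  beyond-not-back : ∀ i x → Beyond i x → x ≢ p (suc i) → ¬ SameComp (p (suc i)) x (p i)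
  beyond-not-back i x (i<L , x≢pi , x~pi+1) x≢pi+1 x~pi
    with lastBefore {P = _≢ p (suc i)} (restrictᶜ (SameComp⇒lazyWalk x~pi) (SameComp-avoids x~pi x≢pi+1)) x≢pi
  ... | y , y≢pi+1 , y~pi , x~y = neighbours-separated {v = p i} y~pi (edge-sym (p-edge i i<L)) y≢pi+1
          (SameComp-trans (SameComp-sym (mapᶜ (λ _ _ s → s) (λ _ → tt) x~y)) x~pi+1)

  π-p : ∀ i → i ≤ L → π (p i) ≡ i
  π-p i i≤L = π-exact (p i) i i≤L below (λ beyond → proj₁ (proj₂ beyond) refl)
    where
    below : ∀ j → j < i → Beyond j (p i)
    below j j<i = <-≤-trans j<i i≤L , (λ pi≡pj → p-injective< j i j<i i≤L (sym pi≡pj)) ,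
      SameComp-sym (segment-avoids j (suc j) i j<i i≤L (≤-trans (<⇒≤ j<i) i≤L) (inj₁ ≤-refl))

  ¬before-π : ∀ x → x ≢ p (π x) → ¬ Before (π x) x
  ¬before-π x with π x | π-below x
  ... | zero | _ = λ _ ()
  ... | suc i | below = beyond-not-back i x (below i ≤-refl)

  OnSpine : V T → Set
  OnSpine x = x ≡ p (π x)

  onSpine-or-hangs : ∀ x → OnSpine x ⊎ HangsAt (π x) x
  onSpine-or-hangs x with x ≟ᶠ p (π x)
  ... | yes on = inj₁ on
  ... | no off = inj₂ (off , ¬beyond-π x , ¬before-π x off)

  -- for j < i, x reaches p (j+1) in T - p j through a neighbour of p i and the spine segment from p (j+1) to p i
  hangs⇒π : ∀ i x → HangsAt i x → i ≤ L → π x ≡ i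
  hangs⇒π i x (x≢pi , ¬beyond , ¬before) i≤L = π-exact x i i≤L (below i refl) ¬beyond
    where
    below : ∀ i₀ → i₀ ≡ i → ∀ j → j < i₀ → Beyond j x
    below (suc i′) refl j j<i = <-≤-trans j<i i≤L , x≢pj , x~pj+1
      where
      j≤i′ : j ≤ i′
      j≤i′ = ≤-pred j<i
      pj~pi′ : SameComp (p (suc i′)) (p j) (p i′)
      pj~pi′ = segment-avoids (suc i′) j i′ j≤i′ (≤-trans (n≤1+n i′) i≤L) i≤L (inj₂ ≤-refl)
      x≢pj : x ≢ p j
      x≢pj refl = ¬before pj~pi′
      nb : Σ (V T) λ y → Edge T y (p (suc i′)) × SameComp (p (suc i′)) x y
      nb = neighbourInComponent (p (suc i′)) x x≢pi
      y : V T
      y = proj₁ nb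
      x~y : SameComp (p (suc i′)) x y
      x~y = proj₂ (proj₂ nb)
      avoids : ∀ t → t ≤ len x~y → at x~y t ≢ p j
      avoids t t≤ hit = ¬before (SameComp-trans (endAtᶜ hit (takeᶜ x~y t t≤)) pj~pi′)
      y≢pj : y ≢ p j
      y≢pj = subst (_≢ p j) (end x~y) (avoids (len x~y) ≤-refl)
      x~pj+1 : SameComp (p j) x (p (suc j))
      x~pj+1 = SameComp-trans (avoiding⇒SameComp (SameComp⇒lazyWalk x~y) avoids)
        (SameComp-trans (SameComp-edge (proj₁ (proj₂ nb)) y≢pj
                          (λ hit → p-injective< j (suc i′) (s≤s j≤i′) i≤L (sym hit)))
          (SameComp-sym (segment-avoids j (suc j) (suc i′) (s≤s j≤i′) i≤L (≤-trans (<⇒≤ j<i) i≤L) (inj₁ ≤-refl))))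

  hangs-SameComp : ∀ i x y → HangsAt i x → SameComp (p i) x y → y ≢ p i → HangsAt i y
  hangs-SameComp zero x y (_ , ¬beyond , _) x~y y≢pi =
    y≢pi , (λ { (i<L , _ , y~) → ¬beyond (i<L , SameComp-≢ (SameComp-sym x~y) y≢pi , SameComp-trans x~y y~) }) , λ ()
  hangs-SameComp (suc i) x y (x≢pi , ¬beyond , ¬before) x~y y≢pi =
    y≢pi , (λ { (i<L , _ , y~) → ¬beyond (i<L , x≢pi , SameComp-trans x~y y~) }) , ¬before ∘ SameComp-trans x~y

  hangs-edge⇒π : ∀ x y → Edge T x y → HangsAt (π x) x → π y ≡ π x
  hangs-edge⇒π x y x~y hangs with y ≟ᶠ p (π x)
  ... | yes y≡ = trans (cong π y≡) (π-p (π x) (π≤L x))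
  ... | no y≢ = hangs⇒π (π x) y (hangs-SameComp (π x) x y hangs (SameComp-edge x~y (proj₁ hangs) y≢) y≢) (π≤L x)

  π-edge : ∀ x y → Edge T x y → π x ≡ π y ⊎ (OnSpine x × OnSpine y)
  π-edge x y x~y with onSpine-or-hangs x | onSpine-or-hangs y
  ... | inj₁ x-on | inj₁ y-on = inj₂ (x-on , y-on)
  ... | inj₂ x-hangs | _ = inj₁ (sym (hangs-edge⇒π x y x~y x-hangs))
  ... | inj₁ _ | inj₂ y-hangs = inj₁ (hangs-edge⇒π y x (edge-sym x~y) y-hangs)

  hangs-apart-u₁ : ∀ i x → HangsAt i x → i ≤ L → ¬ SameComp (p i) x u₁
  hangs-apart-u₁ i x (x≢pi , ¬beyond , _) i≤L x~u₁ with m≤n⇒m<n∨m≡n i≤L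
  ... | inj₁ i<L = ¬beyond (i<L , x≢pi , SameComp-trans (endAtᶜ (sym pL≡u₁) x~u₁)
                     (SameComp-sym (segment-avoids i (suc i) L i<L ≤-refl i≤L (inj₁ ≤-refl))))
  ... | inj₂ refl = SameComp-≢ x~u₁ x≢pi (sym pL≡u₁)

  hangs-apart-u₀ : ∀ i x → HangsAt i x → i ≤ L → ¬ SameComp (p i) x u₀
  hangs-apart-u₀ zero x (x≢pi , _) _ x~u₀ = SameComp-≢ x~u₀ x≢pi (sym p0≡u₀)
  hangs-apart-u₀ (suc i) x (_ , _ , ¬before) i≤L x~u₀ = ¬before (SameComp-trans (endAtᶜ (sym p0≡u₀) x~u₀)
    (segment-avoids (suc i) 0 i z≤n (≤-trans (n≤1+n i) i≤L) i≤L (inj₂ ≤-refl)))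

  L≤i+dist-p-u₁ : ∀ i → i ≤ L → L ≤ i + dist T (p i) u₁
  L≤i+dist-p-u₁ i i≤L = subst (λ z → L ≤ i + dist T (p i) z) pL≡u₁ (p-geodesic i L i≤L ≤-refl)

  i≤dist-p-u₀ : ∀ i → i ≤ L → i ≤ dist T (p i) u₀
  i≤dist-p-u₀ i i≤L =
    subst (i ≤_) (trans (cong (λ z → dist T z (p i)) p0≡u₀) (dist-sym u₀ (p i))) (p-geodesic 0 i z≤n i≤L)

  -- otherwise d(x, u₁) = d(x, p i) + d(p i, u₁) would exceed L = d(u₀, u₁)
  hangs-dist≤i : ∀ i x → HangsAt i x → i ≤ L → dist T x (p i) ≤ i
  hangs-dist≤i i x hangs i≤L = +-cancelʳ-≤ (dist T (p i) u₁) _ _ (begin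
    dist T x (p i) + dist T (p i) u₁ ≤⟨ dist-through (p i) x u₁ (hangs-apart-u₁ i x hangs i≤L) ⟩
    dist T x u₁                      ≤⟨ longest x u₁ ⟩
    L                                ≤⟨ L≤i+dist-p-u₁ i i≤L ⟩
    i + dist T (p i) u₁              ∎)
    where open ≤-Reasoning

  hangs-dist+i≤L : ∀ i x → HangsAt i x → i ≤ L → dist T x (p i) + i ≤ L
  hangs-dist+i≤L i x hangs i≤L = begin
    dist T x (p i) + i               ≤⟨ +-monoʳ-≤ (dist T x (p i)) (i≤dist-p-u₀ i i≤L) ⟩
    dist T x (p i) + dist T (p i) u₀ ≤⟨ dist-through (p i) x u₀ (hangs-apart-u₀ i x hangs i≤L) ⟩
    dist T x u₀                      ≤⟨ longest x u₀ ⟩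
    L                                ∎
    where open ≤-Reasoning

  -- u₀, u₁ and x are the three tips of a triod at p i
  hangs-far⇒≤triodSize : ∀ i x m → HangsAt i x → i ≤ L → 1 ≤ m → m ≤ dist T (p i) x → m ≤ triodSize T
  hangs-far⇒≤triodSize zero x m hangs i≤L 1≤m m≤ =
    contradiction (≤-trans m≤ (≤-trans (≤-reflexive (dist-sym (p 0) x)) (hangs-dist≤i 0 x hangs i≤L))) (<⇒≱ 1≤m)
  hangs-far⇒≤triodSize (suc i′) x m hangs@(x≢pi , ¬beyond , ¬before) i≤L 1≤m m≤ =
    ≤-trans (triod⇒≤eta 1≤m triod) (≤-maxFin (eta T) (p i))
    where
    i : ℕ
    i = suc i′
    m≤dist-x : m ≤ dist T x (p i)
    m≤dist-x = ≤-trans m≤ (≤-reflexive (dist-sym (p i) x))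
    m+i≤L : m + i ≤ L
    m+i≤L = ≤-trans (+-monoˡ-≤ i m≤dist-x) (hangs-dist+i≤L i x hangs i≤L)
    i<L : i < L
    i<L = ≤-trans (+-monoˡ-≤ i 1≤m) m+i≤L
    u₀~pi′ : SameComp (p i) u₀ (p i′)
    u₀~pi′ = startAtᶜ p0≡u₀ (segment-avoids i 0 i′ z≤n (≤-trans (n≤1+n i′) i≤L) i≤L (inj₂ ≤-refl))
    u₁~pi+1 : SameComp (p i) u₁ (p (suc i))
    u₁~pi+1 = startAtᶜ pL≡u₁ (SameComp-sym (segment-avoids i (suc i) L i<L ≤-refl i≤L (inj₁ ≤-refl)))
    triod : Triod (p i) m
    triod = record
      { a₁ = u₀ ; a₂ = u₁ ; a₃ = x
      ; far₁ = (λ u₀≡pi → p-injective< 0 i z<s i≤L (trans p0≡u₀ u₀≡pi)) ,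
               ≤-trans m≤dist-x (≤-trans (hangs-dist≤i i x hangs i≤L) (i≤dist-p-u₀ i i≤L))
      ; far₂ = (λ u₁≡pi → p-injective< i L i<L ≤-refl (sym (trans pL≡u₁ u₁≡pi))) ,
               +-cancelʳ-≤ i m (dist T (p i) u₁)
                 (≤-trans m+i≤L (≤-trans (L≤i+dist-p-u₁ i i≤L) (≤-reflexive (+-comm i _))))
      ; far₃ = x≢pi , m≤
      ; apart₁₂ = λ u₀~u₁ → neighbours-separated (p-edge i′ i≤L) (edge-sym (p-edge i i<L))
                    (λ pi′≡pi+1 → p-injective< i′ (suc i) (m<n⇒m<1+n ≤-refl) i<L pi′≡pi+1)
                    (SameComp-trans (SameComp-sym u₀~pi′) (SameComp-trans u₀~u₁ u₁~pi+1))
      ; apart₁₃ = λ u₀~x → ¬before (SameComp-trans (SameComp-sym u₀~x) u₀~pi′)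
      ; apart₂₃ = λ u₁~x → ¬beyond (i<L , x≢pi , SameComp-trans (SameComp-sym u₁~x) u₁~pi+1) }

  -- a vertex hanging at distance ≥ 1 from the spine is the tip of a triod of size 1
  triodSize≡0⇒allOnSpine : triodSize T ≡ 0 → ∀ x → OnSpine x
  triodSize≡0⇒allOnSpine zero-triods x with onSpine-or-hangs x
  ... | inj₁ on = on
  ... | inj₂ hangs = contradiction (≤-trans (hangs-far⇒≤triodSize (π x) x 1 hangs (π≤L x) ≤-refl
          (≢⇒1≤distance (proj₁ hangs ∘ sym))) (≤-reflexive zero-triods)) λ ()

  allOnSpine⇒L≡suc : (∀ x → OnSpine x) → ∀ (a b : V T) → a ≢ b → ∃ λ L′ → L ≡ suc L′
  allOnSpine⇒L≡suc allOn a b a≢b = cases L refl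
    where
    cases : ∀ l → L ≡ l → ∃ λ L′ → L ≡ suc L′
    cases (suc L′) L≡ = L′ , L≡
    cases zero L≡0 = contradiction (trans (allOn a) (trans (cong p (trans (π≡0 a) (sym (π≡0 b)))) (sym (allOn b)))) a≢b
      where
      π≡0 : ∀ x → π x ≡ 0
      π≡0 x = n≤0⇒n≡0 (subst (π x ≤_) L≡0 (π≤L x))

-- Maps from paths

clamp : ∀ k → ℕ → Fin (suc k)
clamp k t = fromℕ< (s≤s (m⊓n≤n t k))

toℕ-clamp : ∀ k t → t ≤ k → toℕ (clamp k t) ≡ t
toℕ-clamp k t t≤k = trans (toℕ-fromℕ< _) (m≤n⇒m⊓n≡m t≤k)

clamp-toℕ : ∀ k (u : Fin (suc k)) → clamp k (toℕ u) ≡ u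
clamp-toℕ k u = toℕ-injective (toℕ-clamp k (toℕ u) (≤-pred (toℕ<n u)))

pathAdj-suc : ∀ {K} (a b : Fin K) → toℕ b ≡ suc (toℕ a) → Edge (PathGraph K) a b
pathAdj-suc a b b≡a+1 = ∨≡trueʳ _ (≡⇒≡ᵇ≡true (toℕ b) (suc (toℕ a)) b≡a+1)

clamp-edge : ∀ k t → t < k → Edge (PathGraph (suc k)) (clamp k t) (clamp k (suc t))
clamp-edge k t t<k = pathAdj-suc (clamp k t) (clamp k (suc t))
  (trans (toℕ-clamp k (suc t) t<k) (cong suc (sym (toℕ-clamp k t (<⇒≤ t<k)))))

module PathMaps (H : Graph) where
  open GraphWalks H

  weakHom⇒linked : ∀ k (f : Fin (suc k) → V H) → WeakHom (PathGraph (suc k)) H f → Linked LazyStep (f ∘ clamp k) k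
  weakHom⇒linked k f weak t t<k with weak (clamp k t) (clamp k (suc t)) (clamp-edge k t t<k)
  ... | inj₁ e = inj₂ e
  ... | inj₂ stay = inj₁ stay

  surjective⇒hits : ∀ k (f : Fin (suc k) → V H) → (∀ y → ∃ λ x → f x ≡ y) →
    ∀ y → ∃ λ t → t ≤ k × f (clamp k t) ≡ y
  surjective⇒hits k f onto y with onto y
  ... | u , fu≡y = toℕ u , ≤-pred (toℕ<n u) , trans (cong f (clamp-toℕ k u)) fu≡y

  Traverses : (ℕ → V H) → ℕ → V H → V H → Set
  Traverses F K x y = SomeStep (StepIs x y) F K

  CoversEdges : (ℕ → V H) → ℕ → Set
  CoversEdges F K = ∀ x y → Edge H x y → Traverses F K x y ⊎ Traverses F K y x

  -- vertex surjectivity comes from covering an edge at every vertex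
  linked⇒ESWH : ∀ K (F : ℕ → V H) → Linked LazyStep F K → CoversEdges F K → (∀ y → ∃ λ y′ → Edge H y′ y) →
    ESWH (PathGraph (suc K)) H (F ∘ toℕ)
  linked⇒ESWH K F linked covers noIsolated = weak , onto , ontoEdges
    where
    index : ∀ i → i ≤ K → Fin (suc K)
    index i i≤K = fromℕ< (s≤s i≤K)

    F-index : ∀ i i≤K → F (toℕ (index i i≤K)) ≡ F i
    F-index i i≤K = cong F (toℕ-fromℕ< (s≤s i≤K))

    index-edge : ∀ i (i<K : i < K) → Edge (PathGraph (suc K)) (index i (<⇒≤ i<K)) (index (suc i) i<K)
    index-edge i i<K = pathAdj-suc _ _ (trans (toℕ-fromℕ< (s≤s i<K)) (cong suc (sym (toℕ-fromℕ< (s≤s (<⇒≤ i<K))))))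

    forward : ∀ (u v : Fin (suc K)) → toℕ v ≡ suc (toℕ u) → Edge H (F (toℕ u)) (F (toℕ v)) ⊎ F (toℕ u) ≡ F (toℕ v)
    forward u v v≡u+1 with linked (toℕ u) (subst (_≤ K) v≡u+1 (≤-pred (toℕ<n v)))
    ... | inj₁ stay = inj₂ (trans stay (cong F (sym v≡u+1)))
    ... | inj₂ e = inj₁ (subst (λ z → Edge H (F (toℕ u)) (F z)) (sym v≡u+1) e)

    weak : WeakHom (PathGraph (suc K)) H (F ∘ toℕ)
    weak u v u~v with ∨≡true⇒ (toℕ u ≡ᵇ suc (toℕ v)) u~v
    ... | inj₁ u≡v+1 with forward v u (≡ᵇ≡true⇒≡ _ _ u≡v+1)
    ...   | inj₁ e = inj₁ (edge-sym e)
    ...   | inj₂ stay = inj₂ (sym stay)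
    weak u v u~v | inj₂ v≡u+1 = forward u v (≡ᵇ≡true⇒≡ _ _ v≡u+1)

    onto : ∀ y → ∃ λ x → F (toℕ x) ≡ y
    onto y with noIsolated y
    ... | y′ , y′~y with covers y′ y y′~y
    ...   | inj₁ (i , i<K , _ , Fi+1≡y) = index (suc i) i<K , trans (F-index (suc i) i<K) Fi+1≡y
    ...   | inj₂ (i , i<K , Fi≡y , _) = index i (<⇒≤ i<K) , trans (F-index i (<⇒≤ i<K)) Fi≡y

    ontoEdges : ∀ u v → Edge H u v → ∃ λ x → ∃ λ y → Edge (PathGraph (suc K)) x y × F (toℕ x) ≡ u × F (toℕ y) ≡ v
    ontoEdges u v u~v with covers u v u~v
    ... | inj₁ (i , i<K , Fi≡u , Fi+1≡v) = index i (<⇒≤ i<K) , index (suc i) i<K , index-edge i i<K ,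
          trans (F-index i (<⇒≤ i<K)) Fi≡u , trans (F-index (suc i) i<K) Fi+1≡v
    ... | inj₂ (i , i<K , Fi≡v , Fi+1≡u) = index (suc i) i<K , index i (<⇒≤ i<K) ,
          trans (adj-sym (PathGraph (suc K)) (index (suc i) i<K) (index i (<⇒≤ i<K))) (index-edge i i<K) ,
          trans (F-index (suc i) i<K) Fi+1≡u , trans (F-index i (<⇒≤ i<K)) Fi≡v

-- Upper bound

module SpineSteps (T : Graph) (isT : IsTree T) (u₀ u₁ : V T) (longest : ∀ x y → dist T x y ≤ dist T u₀ u₁) where
  open Diameter T isT u₀ u₁ longest public
  open PathMaps T

  π-lazyStep : ∀ x y → LazyStep x y → π x ≡ π y ⊎ (OnSpine x × OnSpine y × Edge T (p (π x)) (p (π y)))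
  π-lazyStep x y (inj₁ refl) = inj₁ refl
  π-lazyStep x y (inj₂ x~y) with π-edge x y x~y
  ... | inj₁ same = inj₁ same
  ... | inj₂ (x-on , y-on) = inj₂ (x-on , y-on , subst₂ (Edge T) x-on y-on x~y)

  π-lazyStep≤ : ∀ x y → LazyStep x y → π y ≤ suc (π x)
  π-lazyStep≤ x y s with π-lazyStep x y s
  ... | inj₁ same = ≤-trans (≤-reflexive (sym same)) (n≤1+n _)
  ... | inj₂ (_ , _ , e) with <-cmp (π x) (π y)
  ...   | tri< πx<πy _ _ = ≤-reflexive (p-edge⇒consecutive _ _ πx<πy (π≤L y) e)
  ...   | tri≈ _ same _ = ≤-trans (≤-reflexive (sym same)) (n≤1+n _)
  ...   | tri> _ _ πy<πx = ≤-trans (<⇒≤ πy<πx) (n≤1+n _)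

  π-moves⇒onSpine : ∀ x y → LazyStep x y → π x ≢ π y → OnSpine x × OnSpine y
  π-moves⇒onSpine x y s moves with π-lazyStep x y s
  ... | inj₁ same = contradiction same moves
  ... | inj₂ (x-on , y-on , _) = x-on , y-on

  module FarApart (m : ℕ) (2≤m : 2 ≤ m) (triod<m : triodSize T < m) where

    record FarWalks (k : ℕ) (F G : ℕ → V T) : Set where
      field
        F-steps : Linked LazyStep F k
        G-steps : Linked LazyStep G k
        far     : ∀ t → t ≤ k → m ≤ dist T (F t) (G t)

    swap : ∀ {k F G} → FarWalks k F G → FarWalks k G F
    swap w = record { F-steps = G-steps ; G-steps = F-steps ; far = λ t t≤ → subst (m ≤_) (dist-sym _ _) (far t t≤) }
      where open FarWalks w

    onSpine-far-sameπ : ∀ x y → m ≤ dist T x y → π x ≡ π y → ¬ OnSpine x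
    onSpine-far-sameπ x y far same x-on with onSpine-or-hangs y
    ... | inj₁ y-on = <⇒≱ 2≤m (≤-trans far (≤-trans (≤-reflexive
            (trans (cong₂ (dist T) (trans x-on (cong p same)) y-on) (distance-refl _))) z≤n))
    ... | inj₂ y-hangs = <⇒≱ triod<m (hangs-far⇒≤triodSize (π y) y m y-hangs (π≤L y) (≤-trans (s≤s z≤n) 2≤m)
            (subst (λ z → m ≤ dist T z y) (trans x-on (cong p same)) far))

    far-sameπ⇒offSpine : ∀ x y → m ≤ dist T x y → π x ≡ π y → ¬ OnSpine x × ¬ OnSpine y
    far-sameπ⇒offSpine x y far same =
      onSpine-far-sameπ x y far same , onSpine-far-sameπ y x (subst (m ≤_) (dist-sym x y) far) (sym same)

    π-stable : ∀ x x′ y y′ → LazyStep x x′ → LazyStep y y′ → m ≤ dist T x y → π x ≡ π y →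
      π x ≡ π x′ × π y ≡ π y′
    π-stable x x′ y y′ sx sy far same with π x ≟ π x′ | π y ≟ π y′
    ... | yes x-stays | yes y-stays = x-stays , y-stays
    ... | no x-moves | _ = contradiction (proj₁ (π-moves⇒onSpine x x′ sx x-moves)) (proj₁ (far-sameπ⇒offSpine x y far same))
    ... | yes _ | no y-moves = contradiction (proj₁ (π-moves⇒onSpine y y′ sy y-moves)) (proj₂ (far-sameπ⇒offSpine x y far same))

    -- π x < π y ≤ 1 + π y′ < 1 + π x′ ≤ 2 + π x forces x, y to be adjacent spine vertices
    no-crossing : ∀ x x′ y y′ → LazyStep x x′ → LazyStep y y′ → m ≤ dist T x y → π x < π y → ¬ (π y′ < π x′)
    no-crossing x x′ y y′ sx sy far πx<πy πy′<πx′ = <⇒≱ 2≤m (≤-trans far adjacent)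
      where
      πx′≤ : π x′ ≤ suc (π x)
      πx′≤ = π-lazyStep≤ x x′ sx
      πy≤ : π y ≤ suc (π y′)
      πy≤ = π-lazyStep≤ y′ y (lazyStep-sym sy)
      πy≡ : π y ≡ suc (π x)
      πy≡ = ≤-antisym (≤-trans πy≤ (≤-trans πy′<πx′ πx′≤)) πx<πy
      πx′≡ : π x′ ≡ suc (π x)
      πx′≡ = ≤-antisym πx′≤ (≤-trans (≤-reflexive (sym πy≡)) (≤-trans πy≤ πy′<πx′))
      x-on : OnSpine x
      x-on = proj₁ (π-moves⇒onSpine x x′ sx (λ same → <-irrefl (trans same πx′≡) ≤-refl))
      y-on : OnSpine y
      y-on = proj₁ (π-moves⇒onSpine y y′ sy
        (λ same → <⇒≱ πy′<πx′ (≤-reflexive (trans πx′≡ (trans (sym πy≡) same)))))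
      adjacent : dist T x y ≤ 1
      adjacent = subst₂ (λ a b → dist T a b ≤ 1) (sym x-on) (sym (trans y-on (cong p πy≡)))
        (distance≤len (stepᶜ {R = LazyStep} {P = U} tt tt (inj₂ (p-edge (π x) (≤-trans (≤-reflexive (sym πy≡)) (π≤L y))))))

    module Invariants {k F G} (w : FarWalks k F G) where
      open FarWalks w

      sameπ-invariant : π (F 0) ≡ π (G 0) → ∀ t → t ≤ k → π (F t) ≡ π (G t)
      sameπ-invariant same zero _ = same
      sameπ-invariant same (suc t) t<k
        with π-stable _ _ _ _ (F-steps t t<k) (G-steps t t<k) (far t (<⇒≤ t<k)) (sameπ-invariant same t (<⇒≤ t<k))
      ... | F-stays , G-stays = trans (sym F-stays) (trans (sameπ-invariant same t (<⇒≤ t<k)) G-stays)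

      π<-invariant : π (F 0) < π (G 0) → ∀ t → t ≤ k → π (F t) < π (G t)
      π<-invariant lt zero _ = lt
      π<-invariant lt (suc t) t<k with <-cmp (π (F (suc t))) (π (G (suc t)))
      ... | tri< lt′ _ _ = lt′
      ... | tri≈ _ same′ _ = contradiction (trans (proj₁ back) (trans same′ (sym (proj₂ back))))
                                           (<⇒≢ (π<-invariant lt t (<⇒≤ t<k)))
        where
        back : π (F t) ≡ π (F (suc t)) × π (G t) ≡ π (G (suc t))
        back with π-stable _ _ _ _ (lazyStep-sym (F-steps t t<k)) (lazyStep-sym (G-steps t t<k)) (far (suc t) t<k) same′
        ... | F-back , G-back = sym F-back , sym G-back
      ... | tri> _ _ gt′ = contradiction gt′
                             (no-crossing _ _ _ _ (F-steps t t<k) (G-steps t t<k) (far t (<⇒≤ t<k)) (π<-invariant lt t (<⇒≤ t<k)))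

    -- F would have to overtake G to reach u₁ = p L
    behind-absurd : ∀ {k F G} → FarWalks k F G → (∃ λ t → t ≤ k × F t ≡ u₁) → ¬ π (F 0) < π (G 0)
    behind-absurd w (t , t≤k , Ft≡u₁) lt = <⇒≱ (Invariants.π<-invariant w lt t t≤k)
      (≤-trans (π≤L _) (≤-reflexive (sym (trans (cong π Ft≡u₁) (trans (cong π (sym pL≡u₁)) (π-p L ≤-refl))))))

    -- when F visits u₀ = p 0 it is on the spine, at the same index as G
    level-absurd : ∀ {k F G} → FarWalks k F G → (∃ λ t → t ≤ k × F t ≡ u₀) → π (F 0) ≢ π (G 0)
    level-absurd w (t , t≤k , Ft≡u₀) same =
      proj₁ (far-sameπ⇒offSpine _ _ (far t t≤k) (Invariants.sameπ-invariant w same t t≤k))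
      (trans Ft≡u₀ (trans (sym p0≡u₀) (cong p (sym (trans (cong π Ft≡u₀) (trans (cong π (sym p0≡u₀)) (π-p 0 z≤n)))))))
      where open FarWalks w

    maps⇒farWalks : ∀ k (f g : Fin (suc k) → V T) → WeakHom (PathGraph (suc k)) T f → WeakHom (PathGraph (suc k)) T g →
      (∀ u → m ≤ dist T (f u) (g u)) → FarWalks k (f ∘ clamp k) (g ∘ clamp k)
    maps⇒farWalks k f g f-weak g-weak far = record
      { F-steps = weakHom⇒linked k f f-weak ; G-steps = weakHom⇒linked k g g-weak ; far = λ t _ → far (clamp k t) }

    far-maps-absurd : ∀ k (f g : Fin (suc k) → V T) → ESWH (PathGraph (suc k)) T f → ESWH (PathGraph (suc k)) T g →
      ¬ (∀ u → m ≤ dist T (f u) (g u))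
    far-maps-absurd k f g (f-weak , f-onto , _) (g-weak , g-onto , _) far
      with <-cmp (π (f (clamp k 0))) (π (g (clamp k 0)))
    ... | tri< lt _ _ = behind-absurd (maps⇒farWalks k f g f-weak g-weak far) (surjective⇒hits k f f-onto u₁) lt
    ... | tri≈ _ same _ = level-absurd (maps⇒farWalks k f g f-weak g-weak far) (surjective⇒hits k f f-onto u₀) same
    ... | tri> _ _ gt = behind-absurd (swap (maps⇒farWalks k f g f-weak g-weak far)) (surjective⇒hits k g g-onto u₁) gt

module UpperBound (T : Graph) (isT : IsTree T) where
  open TreeProperties T isT

  mP≤ : ∀ s → 1 ≤ s → triodSize T ≤ s → ∀ k (f g : Fin (suc k) → V T) →
    ESWH (PathGraph (suc k)) T f → ESWH (PathGraph (suc k)) T g → mP T k f g ≤ s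
  mP≤ s 1≤s triod≤s k f g ef eg with mP T k f g ≤? s
  ... | yes m≤s = m≤s
  ... | no m≰s = contradiction (λ u → minFin-≤ _ u) (FarApart.far-maps-absurd m 2≤m triod<m k f g ef eg)
    where
    m : ℕ
    m = mP T k f g
    2≤m : 2 ≤ m
    2≤m = ≤-trans (s≤s 1≤s) (≰⇒> m≰s)
    triod<m : triodSize T < m
    triod<m = ≤-<-trans triod≤s (≰⇒> m≰s)
    ends : Σ (V T) λ u₀ → Σ (V T) λ u₁ → ∀ x y → dist T x y ≤ dist T u₀ u₁
    ends = diameterEnds T isT
    open SpineSteps T isT (proj₁ ends) (proj₁ (proj₂ ends)) (proj₂ (proj₂ ends))

-- Lower bound from a triod

module PairWalks (G : Graph) where
  open GraphWalks G
  open PathMaps G public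

  PairStep : V G × V G → V G × V G → Set
  PairStep p q = LazyStep (proj₁ p) (proj₁ q) × LazyStep (proj₂ p) (proj₂ q)

  Apart : ℕ → V G × V G → Set
  Apart h p = h ≤ dist G (proj₁ p) (proj₂ p)

  PairWalk : ℕ → V G × V G → V G × V G → Set
  PairWalk h = Chain PairStep (Apart h)

  FirstStepIs SecondStepIs : V G → V G → V G × V G → V G × V G → Set
  FirstStepIs x y p q = StepIs x y (proj₁ p) (proj₁ q)
  SecondStepIs x y p q = StepIs x y (proj₂ p) (proj₂ q)

  parkSecond : ∀ {h} {Q : V G → Set} {s e} a (W : Chain LazyStep Q s e) →
    (∀ t → t ≤ len W → h ≤ dist G (at W t) a) → PairWalk h (s , a) (e , a)
  parkSecond a W apart = chain (len W) (λ t → at W t , a) (λ i i< → steps W i i< , inj₁ refl) apart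
    (cong (_, a) (start W)) (cong (_, a) (end W))

  parkFirst : ∀ {h} {Q : V G → Set} {s e} a (W : Chain LazyStep Q s e) →
    (∀ t → t ≤ len W → h ≤ dist G a (at W t)) → PairWalk h (a , s) (a , e)
  parkFirst a W apart = chain (len W) (λ t → a , at W t) (λ i i< → inj₁ refl , steps W i i<) apart
    (cong (a ,_) (start W)) (cong (a ,_) (end W))

  record Schedule (h : ℕ) : Set where
    field
      from to       : V G × V G
      walk          : PairWalk h from to
      first-covers  : CoversEdges (proj₁ ∘ at walk) (len walk)
      second-covers : CoversEdges (proj₂ ∘ at walk) (len walk)

  schedule⇒maps : ∀ {h} → (∀ y → ∃ λ y′ → Edge G y′ y) → Schedule h →
    ∃ λ k → ∃ λ (f : Fin (suc k) → V G) → ∃ λ (g : Fin (suc k) → V G) →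
      ESWH (PathGraph (suc k)) G f × ESWH (PathGraph (suc k)) G g × h ≤ mP G k f g
  schedule⇒maps noIsolated s = len walk , proj₁ ∘ at walk ∘ toℕ , proj₂ ∘ at walk ∘ toℕ ,
    linked⇒ESWH (len walk) (proj₁ ∘ at walk) (λ i i< → proj₁ (steps walk i i<)) first-covers noIsolated ,
    linked⇒ESWH (len walk) (proj₂ ∘ at walk) (λ i i< → proj₂ (steps walk i i<)) second-covers noIsolated ,
    ≤-minFin _ (λ u → inside walk (toℕ u) (≤-pred (toℕ<n u)))
    where open Schedule s

module TriodSchedule (T : Graph) (isT : IsTree T) (v : V T) (h : ℕ) (triod : Components.Triod T v h) where
  open TreeProperties T isT
  open PairWalks T
  open Triod triod

  parkSecondAt : ∀ {a s e} → FarFrom v h a → Chain LazyStep (Outside v a) s e → PairWalk h (s , a) (e , a)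
  parkSecondAt {a} far W = parkSecond a W λ t t≤ → proj₁ (far-from-outside v a h (proj₂ far) (at W t) (inside W t t≤))

  parkFirstAt : ∀ {a s e} → FarFrom v h a → Chain LazyStep (Outside v a) s e → PairWalk h (a , s) (a , e)
  parkFirstAt {a} far W = parkFirst a W λ t t≤ → proj₂ (far-from-outside v a h (proj₂ far) (at W t) (inside W t t≤))

  apart₂₁ : ¬ SameComp v a₂ a₁
  apart₂₁ = apart₁₂ ∘ SameComp-sym
  apart₃₁ : ¬ SameComp v a₃ a₁
  apart₃₁ = apart₁₃ ∘ SameComp-sym
  apart₃₂ : ¬ SameComp v a₃ a₂
  apart₃₂ = apart₂₃ ∘ SameComp-sym

  tour₁ : Tour v a₁ a₃ a₃
  tour₁ = tour (inj₂ apart₁₃) (inj₂ apart₁₃)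
  tour₂ : Tour v a₂ a₃ a₃
  tour₂ = tour (inj₂ apart₂₃) (inj₂ apart₂₃)
  tour₃ : Tour v a₃ a₂ a₂
  tour₃ = tour (inj₂ apart₃₂) (inj₂ apart₃₂)
  tour₁′ : Tour v a₁ a₂ a₂
  tour₁′ = tour (inj₂ apart₁₂) (inj₂ apart₁₂)

  phase₁ : PairWalk h (a₃ , a₁) (a₃ , a₁)
  phase₁ = parkSecondAt far₁ (proj₁ tour₁)
  phase₂ : PairWalk h (a₃ , a₁) (a₃ , a₂)
  phase₂ = parkFirstAt far₃ (routeOutside (inj₂ apart₃₁) (inj₂ apart₃₂))
  phase₃ : PairWalk h (a₃ , a₂) (a₃ , a₂)
  phase₃ = parkSecondAt far₂ (proj₁ tour₂)
  phase₄ : PairWalk h (a₃ , a₂) (a₃ , a₂)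
  phase₄ = parkFirstAt far₃ (proj₁ tour₃)
  phase₅ : PairWalk h (a₃ , a₂) (a₁ , a₂)
  phase₅ = parkSecondAt far₂ (routeOutside (inj₂ apart₂₃) (inj₂ apart₂₁))
  phase₆ : PairWalk h (a₁ , a₂) (a₁ , a₂)
  phase₆ = parkFirstAt far₁ (proj₁ tour₁′)

  phases₅ : PairWalk h (a₃ , a₂) (a₁ , a₂)
  phases₅ = phase₅ ++ᶜ phase₆
  phases₄ : PairWalk h (a₃ , a₂) (a₁ , a₂)
  phases₄ = phase₄ ++ᶜ phases₅
  phases₃ : PairWalk h (a₃ , a₂) (a₁ , a₂)
  phases₃ = phase₃ ++ᶜ phases₄
  phases₂ : PairWalk h (a₃ , a₁) (a₁ , a₂)
  phases₂ = phase₂ ++ᶜ phases₃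

  -- the first walker tours outside the components of a₁ and of a₂, the second outside those of a₃ and of a₁,
  -- while the other one waits far away at a tip
  triodWalk : PairWalk h (a₃ , a₁) (a₁ , a₂)
  triodWalk = phase₁ ++ᶜ phases₂

  first-covers : CoversEdges (proj₁ ∘ at triodWalk) (len triodWalk)
  first-covers y y′ e = inj₁ ([ (λ (out , out′) → hasStep-++ˡ {Q = Q} phase₁ phases₂ (proj₂ tour₁ y y′ e out out′))
                              , (λ (out , out′) → hasStep-++ʳ {Q = Q} phase₁ phases₂ (hasStep-++ʳ {Q = Q} phase₂ phases₃
                                   (hasStep-++ˡ {Q = Q} phase₃ phases₄ (proj₂ tour₂ y y′ e out out′))))
                              ]′ (edge-outside-either apart₁₂ y y′ e))
    where
    Q : V T × V T → V T × V T → Set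
    Q = FirstStepIs y y′

  second-covers : CoversEdges (proj₂ ∘ at triodWalk) (len triodWalk)
  second-covers y y′ e = inj₁ ([ (λ (out , out′) → hasStep-++ʳ {Q = Q} phase₁ phases₂ (hasStep-++ʳ {Q = Q} phase₂ phases₃
                                    (hasStep-++ʳ {Q = Q} phase₃ phases₄
                                      (hasStep-++ˡ {Q = Q} phase₄ phases₅ (proj₂ tour₃ y y′ e out out′)))))
                               , (λ (out , out′) → hasStep-++ʳ {Q = Q} phase₁ phases₂ (hasStep-++ʳ {Q = Q} phase₂ phases₃
                                    (hasStep-++ʳ {Q = Q} phase₃ phases₄ (hasStep-++ʳ {Q = Q} phase₄ phases₅
                                      (hasStep-++ʳ {Q = Q} phase₅ phase₆ (proj₂ tour₁′ y y′ e out out′))))))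
                               ]′ (edge-outside-either apart₃₁ y y′ e))
    where
    Q : V T × V T → V T × V T → Set
    Q = SecondStepIs y y′

  triodSchedule : Schedule h
  triodSchedule = record { walk = triodWalk ; first-covers = first-covers ; second-covers = second-covers }

-- Lower bound for paths

module SpineSchedule (T : Graph) (isT : IsTree T) (u₀ u₁ : V T) (longest : ∀ x y → dist T x y ≤ dist T u₀ u₁)
                     (allOnSpine : ∀ x → Diameter.OnSpine T isT u₀ u₁ longest x) where
  open Diameter T isT u₀ u₁ longest
  open PairWalks T

  spine-edge : ∀ x y → Edge T x y → π y ≡ suc (π x) ⊎ π x ≡ suc (π y)
  spine-edge x y e with <-cmp (π x) (π y)
  ... | tri< πx<πy _ _ = inj₁ (p-edge⇒consecutive (π x) (π y) πx<πy (π≤L y)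
          (subst₂ (Edge T) (allOnSpine x) (allOnSpine y) e))
  ... | tri≈ _ same _ = contradiction (trans (allOnSpine x) (trans (cong p same) (sym (allOnSpine y)))) (edge⇒≢ e)
  ... | tri> _ _ πy<πx = inj₂ (p-edge⇒consecutive (π y) (π x) πy<πx (π≤L x)
          (subst₂ (Edge T) (allOnSpine y) (allOnSpine x) (edge-sym e)))

  consecutive⇒edge : ∀ x y → π y ≡ suc (π x) → Edge T x y
  consecutive⇒edge x y πy≡ = subst₂ (Edge T) (sym (allOnSpine x)) (trans (cong p (sym πy≡)) (sym (allOnSpine y)))
    (p-edge (π x) (subst (_≤ L) πy≡ (π≤L y)))

  spineCovers⇒coversEdges : ∀ F K → (∀ c → c < L → Traverses F K (p c) (p (suc c)) ⊎ Traverses F K (p (suc c)) (p c)) →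
    CoversEdges F K
  spineCovers⇒coversEdges F K covers x y e with spine-edge x y e
  ... | inj₁ πy≡ = subst₂ (λ a b → Traverses F K a b ⊎ Traverses F K b a) (sym (allOnSpine x))
          (trans (cong p (sym πy≡)) (sym (allOnSpine y))) (covers (π x) (subst (_≤ L) πy≡ (π≤L y)))
  ... | inj₂ πx≡ = Sum.swap (subst₂ (λ a b → Traverses F K a b ⊎ Traverses F K b a) (sym (allOnSpine y))
          (trans (cong p (sym πx≡)) (sym (allOnSpine x))) (covers (π y) (subst (_≤ L) πx≡ (π≤L x))))

  spine-iso : Iso T (PathGraph (suc L))
  spine-iso = record { to = to ; from = p ∘ toℕ ; from∘to = from∘to ; to∘from = to∘from ; pres = pres }
    where
    to : V T → Fin (suc L)
    to x = fromℕ< (s≤s (π≤L x))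
    toℕ-to : ∀ x → toℕ (to x) ≡ π x
    toℕ-to x = toℕ-fromℕ< (s≤s (π≤L x))
    from∘to : ∀ x → p (toℕ (to x)) ≡ x
    from∘to x = trans (cong p (toℕ-to x)) (sym (allOnSpine x))
    to∘from : ∀ i → to (p (toℕ i)) ≡ i
    to∘from i = toℕ-injective (trans (toℕ-to (p (toℕ i))) (π-p (toℕ i) (≤-pred (toℕ<n i))))
    path⇒edge : ∀ u v → Edge (PathGraph (suc L)) (to u) (to v) → Edge T u v
    path⇒edge u v e with ∨≡true⇒ (toℕ (to u) ≡ᵇ suc (toℕ (to v))) e
    ... | inj₁ u≡v+1 = edge-sym (consecutive⇒edge v u
            (trans (sym (toℕ-to u)) (trans (≡ᵇ≡true⇒≡ _ _ u≡v+1) (cong suc (toℕ-to v)))))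
    ... | inj₂ v≡u+1 = consecutive⇒edge u v
            (trans (sym (toℕ-to v)) (trans (≡ᵇ≡true⇒≡ _ _ v≡u+1) (cong suc (toℕ-to u))))
    edge⇒path : ∀ u v → Edge T u v → Edge (PathGraph (suc L)) (to u) (to v)
    edge⇒path u v e with spine-edge u v e
    ... | inj₁ πv≡ = ∨≡trueʳ _ (≡⇒≡ᵇ≡true _ _ (trans (toℕ-to v) (trans πv≡ (cong suc (sym (toℕ-to u))))))
    ... | inj₂ πu≡ = ∨≡trueˡ _ (≡⇒≡ᵇ≡true _ _ (trans (toℕ-to u) (trans πu≡ (cong suc (sym (toℕ-to v))))))
    pres : ∀ u v → adj (PathGraph (suc L)) (to u) (to v) ≡ adj T u v
    pres u v = ≡true⇔⇒≡ (path⇒edge u v) (edge⇒path u v)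

  -- g runs up the spine, f follows, they swap across the last edge, and g runs back down
  module _ (L′ : ℕ) (L≡ : L ≡ suc L′) where

    L′<L : L′ < L
    L′<L = ≤-reflexive (sym L≡)

    1≤L : 1 ≤ L
    1≤L = subst (1 ≤_) (sym L≡) (s≤s z≤n)

    off-segment : ∀ {j l} m → l ≤ L → m < j ⊎ l < m → m ≤ L → ∀ {z} → OnSegment j l z → p m ≢ z
    off-segment m l≤L outside m≤L (c , j≤c , c≤l , refl) pm≡pc with p-injective m c m≤L (≤-trans c≤l l≤L) pm≡pc
    ... | refl = [ (λ m<j → <⇒≱ m<j j≤c) , (λ l<m → <⇒≱ l<m c≤l) ]′ outside

    lower : Chain LazyStep (OnSegment 0 L′) (p 0) (p L′)
    lower = segment 0 L′ z≤n (<⇒≤ L′<L)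
    upper : Chain LazyStep (OnSegment 1 L) (p 1) (p L)
    upper = segment 1 L 1≤L ≤-refl

    phaseA : PairWalk 1 (p 0 , p 1) (p 0 , p L)
    phaseA = parkFirst (p 0) upper λ t t≤ → ≢⇒1≤distance (off-segment 0 ≤-refl (inj₁ z<s) z≤n (inside upper t t≤))

    phaseB : PairWalk 1 (p 0 , p L) (p L′ , p L)
    phaseB = parkSecond (p L) lower λ t t≤ →
      ≢⇒1≤distance (off-segment L (<⇒≤ L′<L) (inj₂ L′<L) ≤-refl (inside lower t t≤) ∘ sym)

    last-step : LazyStep (p L′) (p L)
    last-step = inj₂ (subst (Edge T (p L′) ∘ p) (sym L≡) (p-edge L′ L′<L))

    phaseC : PairWalk 1 (p L′ , p L) (p L , p L′)
    phaseC = stepᶜ (≢⇒1≤distance pL′≢pL) (≢⇒1≤distance (pL′≢pL ∘ sym)) (last-step , lazyStep-sym last-step)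
      where
      pL′≢pL : p L′ ≢ p L
      pL′≢pL = p-injective< L′ L L′<L ≤-refl

    phaseD : PairWalk 1 (p L , p L′) (p L , p 0)
    phaseD = parkFirst (p L) (reverseʷ lower) λ t t≤ →
      ≢⇒1≤distance (off-segment L (<⇒≤ L′<L) (inj₂ L′<L) ≤-refl (inside (reverseʷ lower) t t≤))

    phasesCD : PairWalk 1 (p L′ , p L) (p L , p 0)
    phasesCD = phaseC ++ᶜ phaseD

    phasesBCD : PairWalk 1 (p 0 , p L) (p L , p 0)
    phasesBCD = phaseB ++ᶜ phasesCD

    spineWalk : PairWalk 1 (p 0 , p 1) (p L , p 0)
    spineWalk = phaseA ++ᶜ phasesBCD

    first-covers : ∀ c → c < L → Traverses (proj₁ ∘ at spineWalk) (len spineWalk) (p c) (p (suc c)) ⊎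
                                   Traverses (proj₁ ∘ at spineWalk) (len spineWalk) (p (suc c)) (p c)
    first-covers c c<L = inj₁ (hasStep-++ʳ {Q = Q} phaseA phasesBCD
                           (earlierOrLast (m≤n⇒m<n∨m≡n (≤-pred (subst (c <_) L≡ c<L)))))
      where
      Q : V T × V T → V T × V T → Set
      Q = FirstStepIs (p c) (p (suc c))
      earlierOrLast : c < L′ ⊎ c ≡ L′ → HasStep Q phasesBCD
      earlierOrLast (inj₁ c<L′) = hasStep-++ˡ {Q = Q} phaseB phasesCD (segment-traverses 0 L′ z≤n (<⇒≤ L′<L) c z≤n c<L′)
      earlierOrLast (inj₂ c≡L′) = hasStep-++ʳ {Q = Q} phaseB phasesCD (hasStep-++ˡ {Q = Q} phaseC phaseD
        (0 , z<s , cong p (sym c≡L′) , cong p (trans L≡ (cong suc (sym c≡L′)))))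

    second-covers : ∀ c → c < L → Traverses (proj₂ ∘ at spineWalk) (len spineWalk) (p c) (p (suc c)) ⊎
                                    Traverses (proj₂ ∘ at spineWalk) (len spineWalk) (p (suc c)) (p c)
    second-covers (suc c) c<L = inj₁ (hasStep-++ˡ {Q = SecondStepIs (p (suc c)) (p (suc (suc c)))} phaseA phasesBCD
                                  (segment-traverses 1 L 1≤L ≤-refl (suc c) (s≤s z≤n) c<L))
    second-covers zero _ = inj₂ (hasStep-++ʳ {Q = Q} phaseA phasesBCD (hasStep-++ʳ {Q = Q} phaseB phasesCD (back L′ refl)))
      where
      Q : V T × V T → V T × V T → Set
      Q = SecondStepIs (p 1) (p 0)
      back : ∀ l → L′ ≡ l → HasStep Q phasesCD
      back zero L′≡0 = hasStep-++ˡ {Q = Q} phaseC phaseD (0 , z<s , trans (cong p L≡) (cong (p ∘ suc) L′≡0) , cong p L′≡0)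
      back (suc _) L′≡ = hasStep-++ʳ {Q = Q} phaseC phaseD
        (hasStep-reverse lazyStep-sym lower (segment-traverses 0 L′ z≤n (<⇒≤ L′<L) 0 z≤n (subst (0 <_) (sym L′≡) z<s)))

    spineSchedule : Schedule 1
    spineSchedule = record
      { walk = spineWalk
      ; first-covers = spineCovers⇒coversEdges _ _ first-covers
      ; second-covers = spineCovers⇒coversEdges _ _ second-covers }

-- The three cases

module PathDegrees (G : Graph) {N} (I : Iso G (PathGraph N)) where
  open Iso I

  index : V G → ℕ
  index w = toℕ (to w)

  Adjacent : V G → V G → Set
  Adjacent v w = index v ≡ suc (index w) ⊎ index w ≡ suc (index v)

  edge⇒adjacent : ∀ {v w} → Edge G v w → Adjacent v w
  edge⇒adjacent {v} {w} e = Sum.map (≡ᵇ≡true⇒≡ _ _) (≡ᵇ≡true⇒≡ _ _) (∨≡true⇒ _ (trans (pres v w) e))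

  index-injective : ∀ {w w′} → index w ≡ index w′ → w ≡ w′
  index-injective {w} {w′} eq = trans (sym (from∘to w)) (trans (cong from (toℕ-injective eq)) (from∘to w′))

  -- two of three neighbours lie on the same side of v
  degree<3 : ∀ v → ¬ 3 ≤ degree G v
  degree<3 v 3≤deg with 3≤countFin⇒ (adj G v) 3≤deg
  ... | w₁ , w₂ , w₃ , w₁≢w₂ , w₁≢w₃ , w₂≢w₃ , e₁ , e₂ , e₃ =
    pigeon (edge⇒adjacent e₁) (edge⇒adjacent e₂) (edge⇒adjacent e₃)
    where
    below : ∀ {w w′} → index v ≡ suc (index w) → index v ≡ suc (index w′) → w ≡ w′
    below b b′ = index-injective (suc-injective (trans (sym b) b′))
    above : ∀ {w w′} → index w ≡ suc (index v) → index w′ ≡ suc (index v) → w ≡ w′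
    above a a′ = index-injective (trans a (sym a′))
    pigeon : Adjacent v w₁ → Adjacent v w₂ → Adjacent v w₃ → ⊥
    pigeon (inj₁ b₁) (inj₁ b₂) _ = w₁≢w₂ (below b₁ b₂)
    pigeon (inj₂ a₁) (inj₂ a₂) _ = w₁≢w₂ (above a₁ a₂)
    pigeon (inj₁ b₁) (inj₂ _) (inj₁ b₃) = w₁≢w₃ (below b₁ b₃)
    pigeon (inj₁ _) (inj₂ a₂) (inj₂ a₃) = w₂≢w₃ (above a₂ a₃)
    pigeon (inj₂ a₁) (inj₁ _) (inj₂ a₃) = w₁≢w₃ (above a₁ a₃)
    pigeon (inj₂ _) (inj₁ b₂) (inj₁ b₃) = w₂≢w₃ (below b₂ b₃)

  triodSize≡0 : triodSize G ≡ 0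
  triodSize≡0 = n≤0⇒n≡0 (maxFin-≤ (eta G) λ v → ≤-reflexive (eta≡0 v))
    where
    eta≡0 : ∀ v → eta G v ≡ 0
    eta≡0 v rewrite >⇒≤ᵇ≡false {3} {degree G v} (≰⇒> (degree<3 v)) = refl

module Cases (T : Graph) (isT : IsTree T) where
  open UpperBound T isT
  open PairWalks T

  u₀ u₁ : V T
  u₀ = proj₁ (diameterEnds T isT)
  u₁ = proj₁ (proj₂ (diameterEnds T isT))

  longest : ∀ x y → dist T x y ≤ dist T u₀ u₁
  longest = proj₂ (proj₂ (diameterEnds T isT))

  open Diameter T isT u₀ u₁ longest

  single-vertex : IsTrivial T → (a b : V T) → a ≡ b
  single-vertex one a b = go one a b
    where
    go : ∀ {N} → N ≡ 1 → (a b : Fin N) → a ≡ b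
    go refl zero zero = refl

  two-vertices : ¬ IsTrivial T → Σ (V T) λ a → Σ (V T) λ b → a ≢ b
  two-vertices not-one = go (n T) (proj₁ (proj₁ isT)) not-one
    where
    go : ∀ N → 1 ≤ N → N ≢ 1 → Σ (Fin N) λ a → Σ (Fin N) λ b → a ≢ b
    go (suc zero) _ N≢1 = contradiction refl N≢1
    go (suc (suc N)) _ _ = zero , suc zero , λ ()

  noIsolated : ∀ {a b : V T} → a ≢ b → ∀ y → ∃ λ y′ → Edge T y′ y
  noIsolated {a} {b} a≢b y with y ≟ᶠ a
  ... | yes refl = let (y′ , y′~y , _) = neighbourInComponent y b (a≢b ∘ sym) in y′ , y′~y
  ... | no y≢a = let (y′ , y′~y , _) = neighbourInComponent y a (y≢a ∘ sym) in y′ , y′~y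

  schedule⇒ses : ∀ s → 1 ≤ s → triodSize T ≤ s → (∀ y → ∃ λ y′ → Edge T y′ y) → Schedule s → IsSes T s
  schedule⇒ses s 1≤s triod≤s no-isolated sched with schedule⇒maps no-isolated sched
  ... | k , f , g , ef , eg , s≤m =
    (k , f , g , ef , eg , ≤-antisym (mP≤ s 1≤s triod≤s k f g ef eg) s≤m) , mP≤ s 1≤s triod≤s

  trivial-ses : IsTrivial T → IsSes T 0
  trivial-ses one = (0 , const , const , eswh , eswh , distance-refl u₀) , λ k f g _ _ →
    ≤-trans (minFin-≤ (λ u → dist T (f u) (g u)) zero)
            (≤-reflexive (trans (cong (dist T (f zero)) (single-vertex one (g zero) (f zero))) (distance-refl (f zero))))
    where
    const : Fin 1 → V T
    const _ = u₀
    eswh : ESWH (PathGraph 1) T const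
    eswh = (λ { zero zero () }) , (λ y → zero , single-vertex one u₀ y) ,
           λ u v e → contradiction (single-vertex one u v) (edge⇒≢ e)

  module Triodless {a b : V T} (a≢b : a ≢ b) (no-triod : triodSize T ≡ 0) where

    allOn : ∀ x → OnSpine x
    allOn = triodSize≡0⇒allOnSpine no-triod

    L≡suc : ∃ λ L′ → L ≡ suc L′
    L≡suc = allOnSpine⇒L≡suc allOn a b a≢b

    open SpineSchedule T isT u₀ u₁ longest allOn

    spine-path : IsNontrivialPath T
    spine-path = proj₁ L≡suc , subst (Iso T ∘ PathGraph ∘ suc) (proj₂ L≡suc) spine-iso

    spine-ses : IsSes T 1
    spine-ses = schedule⇒ses 1 ≤-refl (≤-trans (≤-reflexive no-triod) z≤n) (noIsolated a≢b)
      (spineSchedule (proj₁ L≡suc) (proj₂ L≡suc))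

  path-ses : IsNontrivialPath T → IsSes T 1
  path-ses (_ , I) = Triodless.spine-ses a≢b (PathDegrees.triodSize≡0 T I)
    where
    open Iso I
    a≢b : from zero ≢ from (suc zero)
    a≢b a≡b with trans (sym (to∘from zero)) (trans (cong to a≡b) (to∘from (suc zero)))
    ... | ()

  nonpath-ses : ¬ IsTrivial T → ¬ IsNontrivialPath T → IsSes T (triodSize T)
  nonpath-ses not-one not-path with two-vertices not-one
  ... | a , _ , a≢b = schedule⇒ses (triodSize T) 1≤triod ≤-refl (noIsolated a≢b)
    (TriodSchedule.triodSchedule T isT centre (triodSize T) (≤eta⇒triod centre (triodSize T) 1≤triod (≤-reflexive max≡)))
    where
    1≤triod : 1 ≤ triodSize T
    1≤triod = n≢0⇒n>0 (not-path ∘ Triodless.spine-path a≢b)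
    centre : V T
    centre = proj₁ (maxFin-attained (eta T) a)
    max≡ : triodSize T ≡ eta T centre
    max≡ = proj₂ (maxFin-attained (eta T) a)

corollary2p6 : (T : Graph) → IsTree T →
    (IsTrivial T → IsSes T 0) ×
    (IsNontrivialPath T → IsSes T 1) ×
    (¬ IsTrivial T → ¬ IsNontrivialPath T → IsSes T (triodSize T))
corollary2p6 T isT = trivial-ses , path-ses , nonpath-ses
  where open Cases T isT
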